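{- A triangulation of a (rectangular) grid graph is word-representable if and only if it is $3$-colorable.
   Context: A grid graph is the graph of an $m\times n$ rectangle of unit squares: vertices are the corners of the squares and edges are the sides of the squares. A triangulation of it is obtained by adding, in each unit square, exactly one of its two diagonals as an edge. A graph $G=(V,E)$ is word-representable if there is a word $w$ over the alphabet $V$ such that for all distinct $x,y\in V$, the letters $x$ and $y$ alternate in $w$ if and only if $\{x,y\}\in E$. A graph is $3$-colorable if its vertices can be colored with at most $3$ colors so that adjacent vertices receive different colors. -}

module Defs where

open import Data.Nat using (ℕ; zero; suc; _≤_; _<_)
open import Data.Fin using (Fin; toℕ)
open import Data.Fin.Properties as FinP using ()
open import Data.Bool using (Bool; true; false)
open import Data.Product using (Σ; _×_; _,_; ∃)
open import Data.Product.Properties using (≡-dec)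
open import Data.Sum using (_⊎_)
open import Data.List using (List; []; _∷_; filter)
open import Data.List.Membership.Propositional using (_∈_)
open import Relation.Nullary using (¬_)
open import Relation.Nullary.Decidable using (_⊎-dec_)
open import Relation.Binary.PropositionalEquality using (_≡_; _≢_)
open import Relation.Binary.Definitions using (DecidableEquality)
open import Function.Bundles using (_⇔_)

-- Simple graphs given by a vertex type with decidable equality and an
-- edge relation (edges are read as unordered pairs via symmetry below).

record Graph : Set₁ where
  field
    V    : Set
    _≟V_ : DecidableEquality V
    E    : V → V → Set

NoRepeatAdj : {A : Set} → List A → Set
NoRepeatAdj []           = Data.Unit.⊤ where import Data.Unit
NoRepeatAdj (x ∷ [])     = Data.Unit.⊤ where import Data.Unit
NoRepeatAdj (x ∷ y ∷ r)  = (x ≢ y) × NoRepeatAdj (y ∷ r)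

module _ (G : Graph) where
  open Graph G

  restrict : List V → V → V → List V
  restrict w x y = filter (λ z → (z ≟V x) ⊎-dec (z ≟V y)) w

  -- x and y alternate in w: deleting all letters other than x and y
  -- yields xyxy... or yxyx... (of even or odd length), i.e. (since only
  -- the letters x and y remain) no two consecutive letters are equal.
  Alternate : List V → V → V → Set
  Alternate w x y = NoRepeatAdj (restrict w x y)

  Represents : List V → Set
  Represents w = ((v : V) → v ∈ w)
               × ((x y : V) → x ≢ y → (Alternate w x y ⇔ E x y))

  WordRepresentable : Set
  WordRepresentable = Σ (List V) Represents

  ThreeColorable : Set
  ThreeColorable = Σ (V → Fin 3) λ c → (x y : V) → E x y → c x ≢ c y

-- The m × n rectangle of unit squares has vertices (i , j) with
-- 0 ≤ i ≤ m, 0 ≤ j ≤ n.  The unit square with lower-left corner (a , b)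
-- (a < m, b < n) has corners (a,b), (a+1,b), (a,b+1), (a+1,b+1).
-- A triangulation is a choice d a b for every square:
--   d a b ≡ true  : diagonal {(a,b), (a+1,b+1)} is added
--   d a b ≡ false : diagonal {(a+1,b), (a,b+1)} is added

Triangulation : ℕ → ℕ → Set
Triangulation m n = Fin m → Fin n → Bool

-- directed version of the edge set, on ℕ-coordinates
data GridArc (m n : ℕ) (d : Triangulation m n) : ℕ × ℕ → ℕ × ℕ → Set where
  side₁ : ∀ {i j} → i ≤ m → j < n → GridArc m n d (i , j) (i , suc j)
  side₂ : ∀ {i j} → i < m → j ≤ n → GridArc m n d (i , j) (suc i , j)
  diag₁ : (a : Fin m) (b : Fin n) → d a b ≡ true →
          GridArc m n d (toℕ a , toℕ b) (suc (toℕ a) , suc (toℕ b))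
  diag₂ : (a : Fin m) (b : Fin n) → d a b ≡ false →
          GridArc m n d (suc (toℕ a) , toℕ b) (toℕ a , suc (toℕ b))

GridVertex : ℕ → ℕ → Set
GridVertex m n = Fin (suc m) × Fin (suc n)

coords : ∀ {m n} → GridVertex m n → ℕ × ℕ
coords (i , j) = toℕ i , toℕ j

GridEdge : (m n : ℕ) → Triangulation m n → GridVertex m n → GridVertex m n → Set
GridEdge m n d u v = GridArc m n d (coords u) (coords v) ⊎ GridArc m n d (coords v) (coords u)

TriangulatedGrid : (m n : ℕ) → Triangulation m n → Graph
TriangulatedGrid m n d = record
  { V    = GridVertex m n
  ; _≟V_ = ≡-dec FinP._≟_ FinP._≟_
  ; E    = GridEdge m n d
  }

-- Both properties are decided by the parities of the degrees of the
-- interior vertices.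
--  * If an interior vertex has odd degree, its neighbourhood is an odd
--    wheel W₅ or W₇ (checked on the 3 × 3 block around it).  An odd
--    wheel is not 3-colourable, and it is not word-representable: in a
--    representing word the hub and two consecutive rim vertices alternate
--    pairwise, so they follow one of two cyclic orders, and the order
--    must flip from each rim triangle to the next -- impossible around an
--    odd rim.  The two facts about alternation behind this are certified
--    by finite automata over a four-letter alphabet.
--  * If all interior vertices have even degree, every diagonal is
--    determined by a row flip and a column flip, which yield heights P i
--    and Q j such that every edge raises P i + Q j by 1 or 2 in one
--    direction.  The height sum modulo 3 is a 3-colouring, and listing the
--    vertices in rounds ordered by height sum (with a few perturbed
--    rounds) gives a representing word.
module Submission where

open import Defs
open import Data.Nat using (ℕ; zero; suc; pred; _+_; _*_; _∸_; _≤_; _<_; _≰_; z≤n; s≤s; _<?_; _≤?_)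
open import Data.Nat.Properties using () renaming (_≟_ to _≟ℕ_)
open import Data.Nat.Properties hiding (_≟_)
open import Data.Nat.Solver using (module +-*-Solver)
open +-*-Solver using (solve; _:+_; _:*_; _:=_; con)
open import Data.Bool using (Bool; true; false; not; _∧_; _∨_; _xor_; if_then_else_; T) renaming (_≟_ to _≟Bool_)
open import Function using (_∘_)
open import Data.Bool.Properties using (not-involutive; xor-same; xor-identityʳ; not-injective; T-∧; T-≡; T-not-≡; not-distribʳ-xor; ∧-zeroʳ; ∧-identityʳ; ∧-distribˡ-∨)
open import Data.Unit using (⊤; tt)
open import Data.Empty using (⊥; ⊥-elim)
open import Data.Maybe using (Maybe; just; nothing)
open import Data.Product using (Σ; _×_; _,_; proj₁; proj₂; uncurry; map₁)
open import Data.Sum using (_⊎_; inj₁; inj₂)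
open import Data.Fin using (Fin; toℕ; fromℕ<; #_) renaming (zero to fzero; suc to fsuc)
import Data.Fin.Properties as FinP
open import Data.List using (List; []; _∷_; _++_; filter; map; cartesianProduct; allFin)
open import Data.Vec using (Vec; lookup; _∷_; [])
open import Data.Product.Properties using (≡-dec)
open import Data.List.Properties using (filter-++; filter-≐; filter-accept; filter-reject; ++-assoc; ++-identityʳ)
open import Data.List.Membership.Propositional using (_∈_)
open import Data.List.Relation.Unary.Any using (here; there)
open import Data.List.Relation.Unary.All using ([]; _∷_)
open import Data.List.Relation.Unary.AllPairs using ([]; _∷_)
open import Data.List.Relation.Unary.Unique.Propositional using (Unique)
open import Data.List.Relation.Unary.Unique.Propositional.Properties using (filter⁺; cartesianProduct⁺; allFin⁺)
open import Data.List.Membership.Propositional.Properties using (∈-filter⁺; ∈-filter⁻; ∈-++⁺ˡ; ∈-++⁺ʳ; ∈-cartesianProduct⁺; ∈-allFin)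
open import Relation.Nullary using (¬_; Dec; yes; no; does)
open import Relation.Nullary.Decidable using (_⊎-dec_; dec-true; dec-false; T?)
open import Relation.Binary.PropositionalEquality
open import Relation.Binary.Definitions using (DecidableEquality; tri<; tri≈; tri>)
open import Function.Bundles using (_⇔_; mk⇔; Equivalence)

-- To split words we
-- track the letter preceding a segment: `NoRepeatAfter p l` says that l
-- has no equal neighbours and does not start with the letter p.
module Alternation {V : Set} (_≟_ : DecidableEquality V) where

  restrict₂ : List V → V → V → List V
  restrict₂ w x y = filter (λ z → (z ≟ x) ⊎-dec (z ≟ y)) w

  restrict₃ : List V → V → V → V → List V
  restrict₃ w x y z = filter (λ t → (t ≟ x) ⊎-dec ((t ≟ y) ⊎-dec (t ≟ z))) w

  Chain : (V → V → Set) → Maybe V → List V → Set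
  Chain R p        []       = ⊤
  Chain R nothing  (x ∷ xs) = Chain R (just x) xs
  Chain R (just p) (x ∷ xs) = R p x × Chain R (just x) xs

  NoRepeatAfter : Maybe V → List V → Set
  NoRepeatAfter = Chain _≢_

  Alternating : List V → V → V → Set
  Alternating w x y = NoRepeatAfter nothing (restrict₂ w x y)

  lastOf : Maybe V → List V → Maybe V
  lastOf p []       = p
  lastOf p (x ∷ xs) = lastOf (just x) xs

  lastOf-++ : ∀ p xs ys → lastOf p (xs ++ ys) ≡ lastOf (lastOf p xs) ys
  lastOf-++ p []       ys = refl
  lastOf-++ p (x ∷ xs) ys = lastOf-++ (just x) xs ys

  Chain-[] : ∀ {R} p → Chain R p []
  Chain-[] nothing  = tt
  Chain-[] (just _) = tt

  Chain-++⁻ : ∀ {R} p xs ys → Chain R p (xs ++ ys) → Chain R p xs × Chain R (lastOf p xs) ys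
  Chain-++⁻ {R} p    []       ys h       = Chain-[] {R} p , h
  Chain-++⁻ nothing  (x ∷ xs) ys h       = Chain-++⁻ (just x) xs ys h
  Chain-++⁻ (just p) (x ∷ xs) ys (a , h) = let (b , c) = Chain-++⁻ (just x) xs ys h in (a , b) , c

  Chain-++⁺ : ∀ {R} p xs ys → Chain R p xs → Chain R (lastOf p xs) ys → Chain R p (xs ++ ys)
  Chain-++⁺ p        []       ys _        h = h
  Chain-++⁺ nothing  (x ∷ xs) ys h₁       h = Chain-++⁺ (just x) xs ys h₁ h
  Chain-++⁺ (just p) (x ∷ xs) ys (a , h₁) h = a , Chain-++⁺ (just x) xs ys h₁ h

  noRepeatAdj⇔ : ∀ l → NoRepeatAdj l ⇔ NoRepeatAfter nothing l
  noRepeatAdj⇔ l = mk⇔ (to l) (from l)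
    where
    to : ∀ l → NoRepeatAdj l → NoRepeatAfter nothing l
    to []          _       = tt
    to (x ∷ [])    _       = tt
    to (x ∷ y ∷ r) (a , h) = a , to (y ∷ r) h
    from : ∀ l → NoRepeatAfter nothing l → NoRepeatAdj l
    from []          _       = tt
    from (x ∷ [])    _       = tt
    from (x ∷ y ∷ r) (a , h) = a , from (y ∷ r) h

  restrict₂-++ : ∀ xs ys x y → restrict₂ (xs ++ ys) x y ≡ restrict₂ xs x y ++ restrict₂ ys x y
  restrict₂-++ xs ys x y = filter-++ (λ z → (z ≟ x) ⊎-dec (z ≟ y)) xs ys

  restrict₂-swap : ∀ w x y → restrict₂ w x y ≡ restrict₂ w y x
  restrict₂-swap w x y = filter-≐ _ _ ((λ { (inj₁ e) → inj₂ e ; (inj₂ e) → inj₁ e })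
                                     , (λ { (inj₁ e) → inj₂ e ; (inj₂ e) → inj₁ e })) w

  alternating-sym : ∀ w x y → Alternating w y x → Alternating w x y
  alternating-sym w x y = subst (NoRepeatAfter nothing) (restrict₂-swap w y x)

  exactlyTwo : ∀ {u v : V} (l : List V) → Unique l → (∀ z → z ∈ l → z ≡ u ⊎ z ≡ v) → u ∈ l → v ∈ l → u ≢ v →
               l ≡ u ∷ v ∷ [] ⊎ l ≡ v ∷ u ∷ []
  exactlyTwo (a ∷ []) _ _ (here refl) (here refl) u≢v = ⊥-elim (u≢v refl)
  exactlyTwo (a ∷ b ∷ []) ((a∉ ∷ []) ∷ _) only _ _ _
    with only a (here refl) | only b (there (here refl))
  ... | inj₁ refl | inj₂ refl = inj₁ refl
  ... | inj₂ refl | inj₁ refl = inj₂ refl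
  ... | inj₁ refl | inj₁ refl = ⊥-elim (a∉ refl)
  ... | inj₂ refl | inj₂ refl = ⊥-elim (a∉ refl)
  exactlyTwo (a ∷ b ∷ c ∷ l) ((a≢b ∷ a≢c ∷ _) ∷ (b≢c ∷ _) ∷ _) only _ _ _
    with only a (here refl) | only b (there (here refl)) | only c (there (there (here refl)))
  ... | inj₁ refl | inj₁ refl | _         = ⊥-elim (a≢b refl)
  ... | inj₂ refl | inj₂ refl | _         = ⊥-elim (a≢b refl)
  ... | inj₁ refl | inj₂ refl | inj₁ refl = ⊥-elim (a≢c refl)
  ... | inj₁ refl | inj₂ refl | inj₂ refl = ⊥-elim (b≢c refl)
  ... | inj₂ refl | inj₁ refl | inj₁ refl = ⊥-elim (b≢c refl)
  ... | inj₂ refl | inj₁ refl | inj₂ refl = ⊥-elim (a≢c refl)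

  restrict₂-enumeration : ∀ l u v → Unique l → u ∈ l → v ∈ l → u ≢ v →
                          restrict₂ l u v ≡ u ∷ v ∷ [] ⊎ restrict₂ l u v ≡ v ∷ u ∷ []
  restrict₂-enumeration l u v un u∈ v∈ u≢v =
    exactlyTwo (restrict₂ l u v) (filter⁺ P? un) (λ z z∈ → proj₂ (∈-filter⁻ P? {xs = l} z∈))
               (∈-filter⁺ P? u∈ (inj₁ refl)) (∈-filter⁺ P? v∈ (inj₂ refl)) u≢v
    where
    P? : ∀ z → Dec (z ≡ u ⊎ z ≡ v)
    P? z = (z ≟ u) ⊎-dec (z ≟ v)

-- Two facts about
-- alternation are established here by finite automata whose states
-- record the last letter seen in the relevant subwords; they are used
-- in the wheel argument below through a relabelling of the letters.
module Letters where

  data Letter : Set where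
    X Y Z U : Letter

  _=L_ : Letter → Letter → Bool
  X =L X = true
  Y =L Y = true
  Z =L Z = true
  U =L U = true
  _ =L _ = false

  keep : (Letter → Bool) → List (Maybe Letter) → List Letter
  keep S []             = []
  keep S (nothing ∷ w)  = keep S w
  keep S (just l ∷ w)   = if S l then l ∷ keep S w else keep S w

  stepOK : (Letter → Letter → Bool) → Maybe Letter → Letter → Bool
  stepOK R nothing  l = true
  stepOK R (just p) l = R p l

  chain : (Letter → Letter → Bool) → Maybe Letter → List Letter → Bool
  chain R m []       = true
  chain R m (l ∷ ls) = stepOK R m l ∧ chain R (just l) ls

  chain-from : ∀ {R m m'} ls → m' ≡ m → chain R m ls ≡ true → chain R m' ls ≡ true
  chain-from ls refl h = h

  distinct : Letter → Letter → Bool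
  distinct a b = not (a =L b)

  cycXYZ cycXZU cycXZY : Letter → Letter → Bool
  cycXYZ X Y = true
  cycXYZ Y Z = true
  cycXYZ Z X = true
  cycXYZ _ _ = false
  cycXZU X Z = true
  cycXZU Z U = true
  cycXZU U X = true
  cycXZU _ _ = false
  cycXZY X Z = true
  cycXZY Z Y = true
  cycXZY Y X = true
  cycXZY _ _ = false

  inXY inXZ inYZ inYU inXYZ inXZU : Letter → Bool
  inXY X = true
  inXY Y = true
  inXY _ = false
  inXZ X = true
  inXZ Z = true
  inXZ _ = false
  inYZ Y = true
  inYZ Z = true
  inYZ _ = false
  inYU Y = true
  inYU U = true
  inYU _ = false
  inXYZ U = false
  inXYZ _ = true
  inXZU Y = false
  inXZU _ = true

  letterwise : ∀ {f g : Letter → Bool} → f X ≡ g X → f Y ≡ g Y → f Z ≡ g Z → f U ≡ g U → ∀ l → f l ≡ g l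
  letterwise x _ _ _ X = x
  letterwise _ y _ _ Y = y
  letterwise _ _ z _ Z = z
  letterwise _ _ _ u U = u

  ∧-split : ∀ {a b} → a ∧ b ≡ true → (a ≡ true) × (b ≡ true)
  ∧-split {true} {true} _ = refl , refl

  ∧-join : ∀ {a b} → a ≡ true → b ≡ true → a ∧ b ≡ true
  ∧-join refl refl = refl

  -- If the XYZ-subword runs around X→Y→Z and the XZU-subword around
  -- X→Z→U, then Y and U alternate.  State: last X/Y/Z, last X/Z/U and
  -- last Y/U letter read so far.
  module TwoCycles where
    data TwoCyclesState : Set where
      t0 t1 t2 t3 t4 t5 t6 t7 t8 t9 t10 : TwoCyclesState
    lastXYZ : TwoCyclesState → Maybe Letter
    lastXYZ t0 = nothing
    lastXYZ t1 = (just X)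
    lastXYZ t2 = (just Y)
    lastXYZ t3 = (just Z)
    lastXYZ t4 = nothing
    lastXYZ t5 = (just X)
    lastXYZ t6 = (just Y)
    lastXYZ t7 = (just Y)
    lastXYZ t8 = (just Z)
    lastXYZ t9 = (just Z)
    lastXYZ t10 = (just Y)
    lastXZU : TwoCyclesState → Maybe Letter
    lastXZU t0 = nothing
    lastXZU t1 = (just X)
    lastXZU t2 = nothing
    lastXZU t3 = (just Z)
    lastXZU t4 = (just U)
    lastXZU t5 = (just X)
    lastXZU t6 = (just U)
    lastXZU t7 = (just X)
    lastXZU t8 = (just Z)
    lastXZU t9 = (just U)
    lastXZU t10 = (just U)
    lastYU : TwoCyclesState → Maybe Letter
    lastYU t0 = nothing
    lastYU t1 = nothing
    lastYU t2 = (just Y)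
    lastYU t3 = nothing
    lastYU t4 = (just U)
    lastYU t5 = (just U)
    lastYU t6 = (just Y)
    lastYU t7 = (just Y)
    lastYU t8 = (just Y)
    lastYU t9 = (just U)
    lastYU t10 = (just U)
    read₂X : ∀ s → stepOK cycXYZ (lastXYZ s) X ≡ true → stepOK cycXZU (lastXZU s) X ≡ true →
             Σ TwoCyclesState λ s' → (lastXYZ s' ≡ just X) × (lastXZU s' ≡ just X) × (lastYU s' ≡ lastYU s)
    read₂X t0 h0 h1 = t1 , refl , refl , refl
    read₂X t1 () _
    read₂X t2 () _
    read₂X t3 _ ()
    read₂X t4 h0 h1 = t5 , refl , refl , refl
    read₂X t5 () _
    read₂X t6 () _
    read₂X t7 () _
    read₂X t8 _ ()
    read₂X t9 h0 h1 = t5 , refl , refl , refl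
    read₂X t10 () _
    read₂Y : ∀ s → stepOK cycXYZ (lastXYZ s) Y ≡ true →
             Σ TwoCyclesState λ s' → (lastXYZ s' ≡ just Y) × (lastXZU s' ≡ lastXZU s) × (lastYU s' ≡ just Y) × (stepOK distinct (lastYU s) Y ≡ true)
    read₂Y t0 h0 = t2 , refl , refl , refl , refl
    read₂Y t1 h0 = t7 , refl , refl , refl , refl
    read₂Y t2 ()
    read₂Y t3 ()
    read₂Y t4 h0 = t6 , refl , refl , refl , refl
    read₂Y t5 h0 = t7 , refl , refl , refl , refl
    read₂Y t6 ()
    read₂Y t7 ()
    read₂Y t8 ()
    read₂Y t9 ()
    read₂Y t10 ()
    read₂Z : ∀ s → stepOK cycXYZ (lastXYZ s) Z ≡ true → stepOK cycXZU (lastXZU s) Z ≡ true →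
             Σ TwoCyclesState λ s' → (lastXYZ s' ≡ just Z) × (lastXZU s' ≡ just Z) × (lastYU s' ≡ lastYU s)
    read₂Z t0 h0 h1 = t3 , refl , refl , refl
    read₂Z t1 () _
    read₂Z t2 h0 h1 = t8 , refl , refl , refl
    read₂Z t3 () _
    read₂Z t4 _ ()
    read₂Z t5 () _
    read₂Z t6 _ ()
    read₂Z t7 h0 h1 = t8 , refl , refl , refl
    read₂Z t8 () _
    read₂Z t9 () _
    read₂Z t10 _ ()
    read₂U : ∀ s → stepOK cycXZU (lastXZU s) U ≡ true →
             Σ TwoCyclesState λ s' → (lastXYZ s' ≡ lastXYZ s) × (lastXZU s' ≡ just U) × (lastYU s' ≡ just U) × (stepOK distinct (lastYU s) U ≡ true)
    read₂U t0 h0 = t4 , refl , refl , refl , refl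
    read₂U t1 ()
    read₂U t2 h0 = t10 , refl , refl , refl , refl
    read₂U t3 h0 = t9 , refl , refl , refl , refl
    read₂U t4 ()
    read₂U t5 ()
    read₂U t6 ()
    read₂U t7 ()
    read₂U t8 h0 = t9 , refl , refl , refl , refl
    read₂U t9 ()
    read₂U t10 ()

    cycles⇒alternate : ∀ w (s : TwoCyclesState) →
                       chain cycXYZ (lastXYZ s) (keep inXYZ w) ≡ true →
                       chain cycXZU (lastXZU s) (keep inXZU w) ≡ true →
                       chain distinct (lastYU s) (keep inYU w) ≡ true
    cycles⇒alternate [] s h₁ h₂ = refl
    cycles⇒alternate (nothing ∷ w) s h₁ h₂ = cycles⇒alternate w s h₁ h₂
    cycles⇒alternate (just X ∷ w) s h₁ h₂ with ∧-split h₁ | ∧-split h₂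
    ... | a₁ , b₁ | a₂ , b₂ with read₂X s a₁ a₂
    ... | s' , e₁ , e₂ , e₃ = chain-from (keep inYU w) (sym e₃)
            (cycles⇒alternate w s' (chain-from (keep inXYZ w) e₁ b₁) (chain-from (keep inXZU w) e₂ b₂))
    cycles⇒alternate (just Y ∷ w) s h₁ h₂ with ∧-split h₁
    ... | a₁ , b₁ with read₂Y s a₁
    ... | s' , e₁ , e₂ , e₃ , ok = ∧-join ok (chain-from (keep inYU w) (sym e₃)
            (cycles⇒alternate w s' (chain-from (keep inXYZ w) e₁ b₁) (chain-from (keep inXZU w) e₂ h₂)))
    cycles⇒alternate (just Z ∷ w) s h₁ h₂ with ∧-split h₁ | ∧-split h₂
    ... | a₁ , b₁ | a₂ , b₂ with read₂Z s a₁ a₂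
    ... | s' , e₁ , e₂ , e₃ = chain-from (keep inYU w) (sym e₃)
            (cycles⇒alternate w s' (chain-from (keep inXYZ w) e₁ b₁) (chain-from (keep inXZU w) e₂ b₂))
    cycles⇒alternate (just U ∷ w) s h₁ h₂ with ∧-split h₂
    ... | a₂ , b₂ with read₂U s a₂
    ... | s' , e₁ , e₂ , e₃ , ok = ∧-join ok (chain-from (keep inYU w) (sym e₃)
            (cycles⇒alternate w s' (chain-from (keep inXYZ w) e₁ h₁) (chain-from (keep inXZU w) e₂ b₂)))

  -- State: last letters of
  -- the three pair subwords and of the XYZ-subword, and which of the two
  -- orientations is still consistent with the XYZ-subword read so far.
  module Pairwise where
    data PairwiseState : Set where
      u0 u1 u2 u3 u4 u5 u6 u7 u8 u9 : PairwiseState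
    lastXY : PairwiseState → Maybe Letter
    lastXY u0 = nothing
    lastXY u1 = (just X)
    lastXY u2 = (just Y)
    lastXY u3 = nothing
    lastXY u4 = (just X)
    lastXY u5 = (just Y)
    lastXY u6 = (just X)
    lastXY u7 = (just X)
    lastXY u8 = (just Y)
    lastXY u9 = (just Y)
    lastXZ : PairwiseState → Maybe Letter
    lastXZ u0 = nothing
    lastXZ u1 = (just X)
    lastXZ u2 = nothing
    lastXZ u3 = (just Z)
    lastXZ u4 = (just X)
    lastXZ u5 = (just Z)
    lastXZ u6 = (just X)
    lastXZ u7 = (just Z)
    lastXZ u8 = (just X)
    lastXZ u9 = (just Z)
    lastYZ : PairwiseState → Maybe Letter
    lastYZ u0 = nothing
    lastYZ u1 = nothing
    lastYZ u2 = (just Y)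
    lastYZ u3 = (just Z)
    lastYZ u4 = (just Z)
    lastYZ u5 = (just Y)
    lastYZ u6 = (just Y)
    lastYZ u7 = (just Z)
    lastYZ u8 = (just Y)
    lastYZ u9 = (just Z)
    lastXYZ : PairwiseState → Maybe Letter
    lastXYZ u0 = nothing
    lastXYZ u1 = (just X)
    lastXYZ u2 = (just Y)
    lastXYZ u3 = (just Z)
    lastXYZ u4 = (just X)
    lastXYZ u5 = (just Y)
    lastXYZ u6 = (just X)
    lastXYZ u7 = (just Z)
    lastXYZ u8 = (just Y)
    lastXYZ u9 = (just Z)
    keepsXYZ : PairwiseState → Bool
    keepsXYZ u0 = true
    keepsXYZ u1 = true
    keepsXYZ u2 = true
    keepsXYZ u3 = true
    keepsXYZ u4 = true
    keepsXYZ u5 = false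
    keepsXYZ u6 = false
    keepsXYZ u7 = false
    keepsXYZ u8 = true
    keepsXYZ u9 = true
    keepsXZY : PairwiseState → Bool
    keepsXZY u0 = true
    keepsXZY u1 = true
    keepsXZY u2 = true
    keepsXZY u3 = true
    keepsXZY u4 = false
    keepsXZY u5 = true
    keepsXZY u6 = true
    keepsXZY u7 = true
    keepsXZY u8 = false
    keepsXZY u9 = false
    someOrientation : ∀ s → (keepsXYZ s ≡ true) ⊎ (keepsXZY s ≡ true)
    someOrientation u0 = inj₁ refl
    someOrientation u1 = inj₁ refl
    someOrientation u2 = inj₁ refl
    someOrientation u3 = inj₁ refl
    someOrientation u4 = inj₁ refl
    someOrientation u5 = inj₂ refl
    someOrientation u6 = inj₂ refl
    someOrientation u7 = inj₂ refl
    someOrientation u8 = inj₁ refl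
    someOrientation u9 = inj₁ refl
    Consistent : PairwiseState → PairwiseState → Letter → Set
    Consistent s s' x = (lastXYZ s' ≡ just x)
      × (keepsXYZ s' ≡ true → (keepsXYZ s ≡ true) × (stepOK cycXYZ (lastXYZ s) x ≡ true))
      × (keepsXZY s' ≡ true → (keepsXZY s ≡ true) × (stepOK cycXZY (lastXYZ s) x ≡ true))

    read₁X : ∀ s → stepOK distinct (lastXY s) X ≡ true → stepOK distinct (lastXZ s) X ≡ true →
             Σ PairwiseState λ s' → (lastXY s' ≡ just X) × (lastXZ s' ≡ just X) × (lastYZ s' ≡ lastYZ s) × Consistent s s' X
    read₁X u0 _ _ = u1 , refl , refl , refl , refl , (λ _ → refl , refl) , (λ _ → refl , refl)
    read₁X u1 () _
    read₁X u2 _ _ = u6 , refl , refl , refl , refl , (λ ()) , (λ _ → refl , refl)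
    read₁X u3 _ _ = u4 , refl , refl , refl , refl , (λ _ → refl , refl) , (λ ())
    read₁X u4 () _
    read₁X u5 _ _ = u6 , refl , refl , refl , refl , (λ ()) , (λ _ → refl , refl)
    read₁X u6 () _
    read₁X u7 () _
    read₁X u8 _ ()
    read₁X u9 _ _ = u4 , refl , refl , refl , refl , (λ _ → refl , refl) , (λ ())
    read₁Y : ∀ s → stepOK distinct (lastXY s) Y ≡ true → stepOK distinct (lastYZ s) Y ≡ true →
             Σ PairwiseState λ s' → (lastXY s' ≡ just Y) × (lastXZ s' ≡ lastXZ s) × (lastYZ s' ≡ just Y) × Consistent s s' Y
    read₁Y u0 _ _ = u2 , refl , refl , refl , refl , (λ _ → refl , refl) , (λ _ → refl , refl)
    read₁Y u1 _ _ = u8 , refl , refl , refl , refl , (λ _ → refl , refl) , (λ ())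
    read₁Y u2 () _
    read₁Y u3 _ _ = u5 , refl , refl , refl , refl , (λ ()) , (λ _ → refl , refl)
    read₁Y u4 _ _ = u8 , refl , refl , refl , refl , (λ _ → refl , refl) , (λ ())
    read₁Y u5 () _
    read₁Y u6 _ ()
    read₁Y u7 _ _ = u5 , refl , refl , refl , refl , (λ ()) , (λ _ → refl , refl)
    read₁Y u8 () _
    read₁Y u9 () _
    read₁Z : ∀ s → stepOK distinct (lastXZ s) Z ≡ true → stepOK distinct (lastYZ s) Z ≡ true →
             Σ PairwiseState λ s' → (lastXY s' ≡ lastXY s) × (lastXZ s' ≡ just Z) × (lastYZ s' ≡ just Z) × Consistent s s' Z
    read₁Z u0 _ _ = u3 , refl , refl , refl , refl , (λ _ → refl , refl) , (λ _ → refl , refl)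
    read₁Z u1 _ _ = u7 , refl , refl , refl , refl , (λ ()) , (λ _ → refl , refl)
    read₁Z u2 _ _ = u9 , refl , refl , refl , refl , (λ _ → refl , refl) , (λ ())
    read₁Z u3 () _
    read₁Z u4 _ ()
    read₁Z u5 () _
    read₁Z u6 _ _ = u7 , refl , refl , refl , refl , (λ ()) , (λ _ → refl , refl)
    read₁Z u7 () _
    read₁Z u8 _ _ = u9 , refl , refl , refl , refl , (λ _ → refl , refl) , (λ ())
    read₁Z u9 () _

    Oriented : PairwiseState → List Letter → Set
    Oriented s l = ((keepsXYZ s ≡ true) × (chain cycXYZ (lastXYZ s) l ≡ true))
                 ⊎ ((keepsXZY s ≡ true) × (chain cycXZY (lastXYZ s) l ≡ true))

    extend : ∀ {s s' x} l → Consistent s s' x → Oriented s' l → Oriented s (x ∷ l)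
    extend l (e , ca , cb) (inj₁ (k , c)) = inj₁ (proj₁ (ca k) , ∧-join (proj₂ (ca k)) (chain-from l (sym e) c))
    extend l (e , ca , cb) (inj₂ (k , c)) = inj₂ (proj₁ (cb k) , ∧-join (proj₂ (cb k)) (chain-from l (sym e) c))

    pairwise⇒oriented : ∀ w (s : PairwiseState) →
                        chain distinct (lastXY s) (keep inXY w) ≡ true →
                        chain distinct (lastXZ s) (keep inXZ w) ≡ true →
                        chain distinct (lastYZ s) (keep inYZ w) ≡ true →
                        Oriented s (keep inXYZ w)
    pairwise⇒oriented [] s h₁ h₂ h₃ with someOrientation s
    ... | inj₁ k = inj₁ (k , refl)
    ... | inj₂ k = inj₂ (k , refl)
    pairwise⇒oriented (nothing ∷ w) s h₁ h₂ h₃ = pairwise⇒oriented w s h₁ h₂ h₃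
    pairwise⇒oriented (just X ∷ w) s h₁ h₂ h₃ with ∧-split h₁ | ∧-split h₂
    ... | a₁ , b₁ | a₂ , b₂ with read₁X s a₁ a₂
    ... | s' , e₁ , e₂ , e₃ , c = extend (keep inXYZ w) c
            (pairwise⇒oriented w s' (chain-from (keep inXY w) e₁ b₁) (chain-from (keep inXZ w) e₂ b₂)
                                    (chain-from (keep inYZ w) e₃ h₃))
    pairwise⇒oriented (just Y ∷ w) s h₁ h₂ h₃ with ∧-split h₁ | ∧-split h₃
    ... | a₁ , b₁ | a₃ , b₃ with read₁Y s a₁ a₃
    ... | s' , e₁ , e₂ , e₃ , c = extend (keep inXYZ w) c
            (pairwise⇒oriented w s' (chain-from (keep inXY w) e₁ b₁) (chain-from (keep inXZ w) e₂ h₂)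
                                    (chain-from (keep inYZ w) e₃ b₃))
    pairwise⇒oriented (just Z ∷ w) s h₁ h₂ h₃ with ∧-split h₂ | ∧-split h₃
    ... | a₂ , b₂ | a₃ , b₃ with read₁Z s a₂ a₃
    ... | s' , e₁ , e₂ , e₃ , c = extend (keep inXYZ w) c
            (pairwise⇒oriented w s' (chain-from (keep inXY w) e₁ h₁) (chain-from (keep inXZ w) e₂ b₂)
                                    (chain-from (keep inYZ w) e₃ b₃))
    pairwise⇒oriented (just U ∷ w) s h₁ h₂ h₃ = pairwise⇒oriented w s h₁ h₂ h₃

-- Three facts about alternation in words over any alphabet, obtained
-- from the automata above by relabelling four distinct letters
-- x, y, z, u as X, Y, Z, U.
module Triples {V : Set} (_≟_ : DecidableEquality V) where
  open Alternation _≟_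
  open Letters

  CyclicStep : V → V → V → V → V → Set
  CyclicStep x y z p q = (p ≡ x × q ≡ y) ⊎ (p ≡ y × q ≡ z) ⊎ (p ≡ z × q ≡ x)

  RunsAround : List V → V → V → V → Set
  RunsAround w x y z = Chain (CyclicStep x y z) nothing (restrict₃ w x y z)

  module Relabel (x y z u : V) (xy : x ≢ y) (xz : x ≢ z) (xu : x ≢ u)
                 (yz : y ≢ z) (yu : y ≢ u) (zu : z ≢ u) where

    ⟦_⟧ : Letter → V
    ⟦ X ⟧ = x
    ⟦ Y ⟧ = y
    ⟦ Z ⟧ = z
    ⟦ U ⟧ = u

    ⟦⟧-distinct : ∀ a b → (a =L b) ≡ false → ⟦ a ⟧ ≢ ⟦ b ⟧
    ⟦⟧-distinct X Y _ = xy
    ⟦⟧-distinct X Z _ = xz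
    ⟦⟧-distinct X U _ = xu
    ⟦⟧-distinct Y X _ = ≢-sym xy
    ⟦⟧-distinct Y Z _ = yz
    ⟦⟧-distinct Y U _ = yu
    ⟦⟧-distinct Z X _ = ≢-sym xz
    ⟦⟧-distinct Z Y _ = ≢-sym yz
    ⟦⟧-distinct Z U _ = zu
    ⟦⟧-distinct U X _ = ≢-sym xu
    ⟦⟧-distinct U Y _ = ≢-sym yu
    ⟦⟧-distinct U Z _ = ≢-sym zu

    =L-sound : ∀ a b → (a =L b) ≡ true → a ≡ b
    =L-sound X X _ = refl
    =L-sound Y Y _ = refl
    =L-sound Z Z _ = refl
    =L-sound U U _ = refl

    ⟦⟧-injective : ∀ a b → ⟦ a ⟧ ≡ ⟦ b ⟧ → a ≡ b
    ⟦⟧-injective a b e with a =L b in eq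
    ... | true  = =L-sound a b eq
    ... | false = ⊥-elim (⟦⟧-distinct a b eq e)

    does-⟦⟧ : ∀ a b → does (⟦ a ⟧ ≟ ⟦ b ⟧) ≡ (a =L b)
    does-⟦⟧ a b with a =L b in eq
    ... | true  = dec-true (⟦ a ⟧ ≟ ⟦ b ⟧) (cong ⟦_⟧ (=L-sound a b eq))
    ... | false = dec-false (⟦ a ⟧ ≟ ⟦ b ⟧) (⟦⟧-distinct a b eq)

    Other : V → Set
    Other t = ∀ a → t ≢ ⟦ a ⟧

    data Classified (t : V) : Set where
      labelled : (l : Letter) → t ≡ ⟦ l ⟧ → Classified t
      other    : Other t → Classified t

    classify : ∀ t → Classified t
    classify t with t ≟ x | t ≟ y | t ≟ z | t ≟ u
    ... | yes e | _     | _     | _     = labelled X e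
    ... | no _  | yes e | _     | _     = labelled Y e
    ... | no _  | no _  | yes e | _     = labelled Z e
    ... | no _  | no _  | no _  | yes e = labelled U e
    ... | no a  | no b  | no c  | no d  = other λ { X → a ; Y → b ; Z → c ; U → d }

    label : V → Maybe Letter
    label t with classify t
    ... | labelled l _ = just l
    ... | other _      = nothing

    labels : List V → List (Maybe Letter)
    labels = map label

    filter-relabel : {P : V → Set} (P? : ∀ t → Dec (P t)) (S : Letter → Bool) →
                     (∀ l → does (P? ⟦ l ⟧) ≡ S l) → (∀ t → Other t → does (P? t) ≡ false) →
                     ∀ w → filter P? w ≡ map ⟦_⟧ (keep S (labels w))
    filter-relabel P? S hS hO [] = refl
    filter-relabel P? S hS hO (t ∷ w) with classify t
    ... | labelled l refl with does (P? ⟦ l ⟧) | S l | hS l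
    ...   | true  | true  | refl = cong (⟦ l ⟧ ∷_) (filter-relabel P? S hS hO w)
    ...   | false | false | refl = filter-relabel P? S hS hO w
    filter-relabel P? S hS hO (t ∷ w) | other o with does (P? t) | hO t o
    ... | false | refl = filter-relabel P? S hS hO w

    restrict₂-relabel : ∀ a b (S : Letter → Bool) → (∀ l → (l =L a) ∨ (l =L b) ≡ S l) →
                        ∀ w → restrict₂ w ⟦ a ⟧ ⟦ b ⟧ ≡ map ⟦_⟧ (keep S (labels w))
    restrict₂-relabel a b S hS = filter-relabel _ S
      (λ l → trans (cong₂ _∨_ (does-⟦⟧ l a) (does-⟦⟧ l b)) (hS l))
      (λ t o → cong₂ _∨_ (dec-false (t ≟ ⟦ a ⟧) (o a)) (dec-false (t ≟ ⟦ b ⟧) (o b)))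

    restrict₃-relabel : ∀ a b c (S : Letter → Bool) → (∀ l → (l =L a) ∨ (l =L b) ∨ (l =L c) ≡ S l) →
                        ∀ w → restrict₃ w ⟦ a ⟧ ⟦ b ⟧ ⟦ c ⟧ ≡ map ⟦_⟧ (keep S (labels w))
    restrict₃-relabel a b c S hS = filter-relabel _ S
      (λ l → trans (cong₂ _∨_ (does-⟦⟧ l a) (cong₂ _∨_ (does-⟦⟧ l b) (does-⟦⟧ l c))) (hS l))
      (λ t o → cong₂ _∨_ (dec-false (t ≟ ⟦ a ⟧) (o a))
                         (cong₂ _∨_ (dec-false (t ≟ ⟦ b ⟧) (o b)) (dec-false (t ≟ ⟦ c ⟧) (o c))))

    emb : Maybe Letter → Maybe V
    emb nothing  = nothing
    emb (just l) = just ⟦ l ⟧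

    chain-relabel→ : ∀ {R r} → (∀ p l → R ⟦ p ⟧ ⟦ l ⟧ → r p l ≡ true) →
                     ∀ m ls → Chain R (emb m) (map ⟦_⟧ ls) → chain r m ls ≡ true
    chain-relabel→ hr m        []       _       = refl
    chain-relabel→ hr nothing  (l ∷ ls) h       = chain-relabel→ hr (just l) ls h
    chain-relabel→ hr (just p) (l ∷ ls) (a , h) = ∧-join (hr p l a) (chain-relabel→ hr (just l) ls h)

    chain-relabel← : ∀ {R r} → (∀ p l → r p l ≡ true → R ⟦ p ⟧ ⟦ l ⟧) →
                     ∀ m ls → chain r m ls ≡ true → Chain R (emb m) (map ⟦_⟧ ls)
    chain-relabel← {R} hr m        []       _ = Chain-[] {R} (emb m)
    chain-relabel← {R} hr nothing  (l ∷ ls) h = chain-relabel← hr (just l) ls h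
    chain-relabel← hr (just p) (l ∷ ls) h =
      let (a , b) = ∧-split h in hr p l a , chain-relabel← hr (just l) ls b

    distinct→ : ∀ p l → ⟦ p ⟧ ≢ ⟦ l ⟧ → distinct p l ≡ true
    distinct→ p l ne with p =L l in eq
    ... | true  = ⊥-elim (ne (cong ⟦_⟧ (=L-sound p l eq)))
    ... | false = refl

    distinct← : ∀ p l → distinct p l ≡ true → ⟦ p ⟧ ≢ ⟦ l ⟧
    distinct← p l h with p =L l in eq
    distinct← p l () | true
    ... | false = ⟦⟧-distinct p l eq

    cycXYZ→ : ∀ p l → CyclicStep x y z ⟦ p ⟧ ⟦ l ⟧ → cycXYZ p l ≡ true
    cycXYZ→ p l (inj₁ (a , b))        rewrite ⟦⟧-injective p X a | ⟦⟧-injective l Y b = refl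
    cycXYZ→ p l (inj₂ (inj₁ (a , b))) rewrite ⟦⟧-injective p Y a | ⟦⟧-injective l Z b = refl
    cycXYZ→ p l (inj₂ (inj₂ (a , b))) rewrite ⟦⟧-injective p Z a | ⟦⟧-injective l X b = refl

    cycXZU→ : ∀ p l → CyclicStep x z u ⟦ p ⟧ ⟦ l ⟧ → cycXZU p l ≡ true
    cycXZU→ p l (inj₁ (a , b))        rewrite ⟦⟧-injective p X a | ⟦⟧-injective l Z b = refl
    cycXZU→ p l (inj₂ (inj₁ (a , b))) rewrite ⟦⟧-injective p Z a | ⟦⟧-injective l U b = refl
    cycXZU→ p l (inj₂ (inj₂ (a , b))) rewrite ⟦⟧-injective p U a | ⟦⟧-injective l X b = refl

    cycXYZ← : ∀ p l → cycXYZ p l ≡ true → CyclicStep x y z ⟦ p ⟧ ⟦ l ⟧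
    cycXYZ← X Y _ = inj₁ (refl , refl)
    cycXYZ← Y Z _ = inj₂ (inj₁ (refl , refl))
    cycXYZ← Z X _ = inj₂ (inj₂ (refl , refl))

    cycXZY← : ∀ p l → cycXZY p l ≡ true → CyclicStep x z y ⟦ p ⟧ ⟦ l ⟧
    cycXZY← X Z _ = inj₁ (refl , refl)
    cycXZY← Z Y _ = inj₂ (inj₁ (refl , refl))
    cycXZY← Y X _ = inj₂ (inj₂ (refl , refl))

    alternating→ : ∀ a b S → (∀ l → (l =L a) ∨ (l =L b) ≡ S l) →
                   ∀ w → Alternating w ⟦ a ⟧ ⟦ b ⟧ → chain distinct nothing (keep S (labels w)) ≡ true
    alternating→ a b S hS w h =
      chain-relabel→ {R = _≢_} distinct→ nothing (keep S (labels w)) (subst (NoRepeatAfter nothing) (restrict₂-relabel a b S hS w) h)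

    runsAround→ : ∀ a b c S r → (∀ l → (l =L a) ∨ (l =L b) ∨ (l =L c) ≡ S l) →
                  (∀ p l → CyclicStep ⟦ a ⟧ ⟦ b ⟧ ⟦ c ⟧ ⟦ p ⟧ ⟦ l ⟧ → r p l ≡ true) →
                  ∀ w → RunsAround w ⟦ a ⟧ ⟦ b ⟧ ⟦ c ⟧ → chain r nothing (keep S (labels w)) ≡ true
    runsAround→ a b c S r hS hr w h =
      chain-relabel→ {R = CyclicStep ⟦ a ⟧ ⟦ b ⟧ ⟦ c ⟧} hr nothing (keep S (labels w)) (subst (Chain _ nothing) (restrict₃-relabel a b c S hS w) h)

    runsAround← : ∀ a b c S r → (∀ l → (l =L a) ∨ (l =L b) ∨ (l =L c) ≡ S l) →
                  (∀ p l → r p l ≡ true → CyclicStep ⟦ a ⟧ ⟦ b ⟧ ⟦ c ⟧ ⟦ p ⟧ ⟦ l ⟧) →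
                  ∀ w → chain r nothing (keep S (labels w)) ≡ true → RunsAround w ⟦ a ⟧ ⟦ b ⟧ ⟦ c ⟧
    runsAround← a b c S r hS hr w h =
      subst (Chain _ nothing) (sym (restrict₃-relabel a b c S hS w)) (chain-relabel← {R = CyclicStep ⟦ a ⟧ ⟦ b ⟧ ⟦ c ⟧} hr nothing (keep S (labels w)) h)

    pairwise⇒runsAround : ∀ w → Alternating w x y → Alternating w x z → Alternating w y z →
                          RunsAround w x y z ⊎ RunsAround w x z y
    pairwise⇒runsAround w h₁ h₂ h₃
      with Pairwise.pairwise⇒oriented (labels w) Pairwise.u0
             (alternating→ X Y inXY (letterwise refl refl refl refl) w h₁) (alternating→ X Z inXZ (letterwise refl refl refl refl) w h₂)
             (alternating→ Y Z inYZ (letterwise refl refl refl refl) w h₃)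
    ... | inj₁ (_ , c) = inj₁ (runsAround← X Y Z inXYZ cycXYZ (letterwise refl refl refl refl) cycXYZ← w c)
    ... | inj₂ (_ , c) = inj₂ (runsAround← X Z Y inXYZ cycXZY (letterwise refl refl refl refl) cycXZY← w c)

    runsAround⇒alternating : ∀ w → RunsAround w x y z → RunsAround w x z u → Alternating w y u
    runsAround⇒alternating w h₁ h₂ =
      subst (NoRepeatAfter nothing) (sym (restrict₂-relabel Y U inYU (letterwise refl refl refl refl) w))
        (chain-relabel← {R = _≢_} distinct← nothing (keep inYU (labels w))
          (TwoCycles.cycles⇒alternate (labels w) TwoCycles.t0
            (runsAround→ X Y Z inXYZ cycXYZ (letterwise refl refl refl refl) cycXYZ→ w h₁)
            (runsAround→ X Z U inXZU cycXZU (letterwise refl refl refl refl) cycXZU→ w h₂)))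

  data Orientation (w : List V) (x a b : V) : Set where
    clockwise     : RunsAround w x a b → Orientation w x a b
    anticlockwise : RunsAround w x b a → Orientation w x a b

  isClockwise : ∀ {w x a b} → Orientation w x a b → Bool
  isClockwise (clockwise _)     = true
  isClockwise (anticlockwise _) = false

  orientation : ∀ w x a b c → x ≢ a → x ≢ b → x ≢ c → a ≢ b → a ≢ c → b ≢ c →
                Alternating w x a → Alternating w x b → Alternating w a b → Orientation w x a b
  orientation w x a b c xa xb xc ab ac bc h₁ h₂ h₃
    with Relabel.pairwise⇒runsAround x a b c xa xb xc ab ac bc w h₁ h₂ h₃
  ... | inj₁ r = clockwise r
  ... | inj₂ r = anticlockwise r

  orientation-flips : ∀ w x a b c → x ≢ a → x ≢ b → x ≢ c → a ≢ b → a ≢ c → b ≢ c →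
                      (o₁ : Orientation w x a b) (o₂ : Orientation w x b c) →
                      ¬ Alternating w a c → isClockwise o₁ ≢ isClockwise o₂
  orientation-flips w x a b c xa xb xc ab ac bc (clockwise r₁) (clockwise r₂) ¬ac _ =
    ¬ac (Relabel.runsAround⇒alternating x a b c xa xb xc ab ac bc w r₁ r₂)
  orientation-flips w x a b c xa xb xc ab ac bc (anticlockwise r₁) (anticlockwise r₂) ¬ac _ =
    ¬ac (alternating-sym w a c (Relabel.runsAround⇒alternating x c b a xc xb xa
           (≢-sym bc) (≢-sym ac) (≢-sym ab) w r₂ r₁))
  orientation-flips w x a b c xa xb xc ab ac bc (clockwise _) (anticlockwise _) ¬ac ()
  orientation-flips w x a b c xa xb xc ab ac bc (anticlockwise _) (clockwise _) ¬ac ()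

record OddCycle (p : ℕ) : Set where
  field
    next          : Fin p → Fin p
    not-bipartite : (b : Fin p → Bool) → (∀ k → b k ≢ b (next k)) → ⊥

module _ {p : ℕ} {next : Fin p → Fin p} {b : Fin p → Bool} (alt : ∀ k → b k ≢ b (next k)) where

  flips : ∀ k → b (next k) ≡ not (b k)
  flips k with b k | b (next k) | alt k
  ... | false | true  | _ = refl
  ... | true  | false | _ = refl
  ... | false | false | h = ⊥-elim (h refl)
  ... | true  | true  | h = ⊥-elim (h refl)

  flips-twice : ∀ k → b (next (next k)) ≡ b k
  flips-twice k = trans (flips (next k)) (trans (cong not (flips k)) (not-involutive (b k)))

false≢true : false ≢ true
false≢true ()

not-fixed : ∀ b → b ≢ not b
not-fixed true  ()
not-fixed false ()

-- the cycles 0 → 1 → ⋯ → 4 → 0 and 0 → 1 → ⋯ → 6 → 0: two-step moves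
-- give b 0 ≡ b 4 (resp. b 6), while the step back to 0 gives b 0 ≡ not (b 4)
cycle5 : OddCycle 5
cycle5 = record { next = next ; not-bipartite = λ b alt →
  not-fixed (b f0) (trans (flips alt f4) (cong not (trans (flips-twice alt f2) (flips-twice alt f0)))) }
  where
  f0 f1 f2 f3 f4 : Fin 5
  f0 = fzero
  f1 = # 1
  f2 = # 2
  f3 = # 3
  f4 = # 4
  next : Fin 5 → Fin 5
  next (fsuc (fsuc (fsuc (fsuc fzero)))) = f0
  next (fsuc (fsuc (fsuc fzero)))        = f4
  next (fsuc (fsuc fzero))               = f3
  next (fsuc fzero)                      = f2
  next fzero                             = f1

cycle7 : OddCycle 7
cycle7 = record { next = next ; not-bipartite = λ b alt →
  not-fixed (b f0) (trans (flips alt f6) (cong not (trans (flips-twice alt f4)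
    (trans (flips-twice alt f2) (flips-twice alt f0))))) }
  where
  f0 f1 f2 f3 f4 f5 f6 : Fin 7
  f0 = fzero
  f1 = # 1
  f2 = # 2
  f3 = # 3
  f4 = # 4
  f5 = # 5
  f6 = # 6
  next : Fin 7 → Fin 7
  next (fsuc (fsuc (fsuc (fsuc (fsuc (fsuc fzero)))))) = f0
  next (fsuc (fsuc (fsuc (fsuc (fsuc fzero)))))        = f6
  next (fsuc (fsuc (fsuc (fsuc fzero))))               = f5
  next (fsuc (fsuc (fsuc fzero)))                      = f4
  next (fsuc (fsuc fzero))                             = f3
  next (fsuc fzero)                                    = f2
  next fzero                                           = f1

rot : Fin 3 → Fin 3
rot fzero               = # 1
rot (fsuc fzero)        = # 2
rot (fsuc (fsuc fzero)) = # 0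

mod3 : ℕ → Fin 3
mod3 zero    = # 0
mod3 (suc k) = rot (mod3 k)

mod3-≢ : ∀ {x y} → x < y → y ≤ 2 + x → mod3 x ≢ mod3 y
mod3-≢ {x} {suc y} (s≤s x≤y) y≤1+x with m≤n⇒m<n∨m≡n x≤y
... | inj₂ refl = rot-≢ (mod3 x)
  where
  rot-≢ : ∀ c → c ≢ rot c
  rot-≢ fzero ()
  rot-≢ (fsuc fzero) ()
  rot-≢ (fsuc (fsuc fzero)) ()
... | inj₁ x<y with ≤-antisym (≤-pred y≤1+x) x<y
... | refl = rot²-≢ (mod3 x)
  where
  rot²-≢ : ∀ c → c ≢ rot (rot c)
  rot²-≢ fzero ()
  rot²-≢ (fsuc fzero) ()
  rot²-≢ (fsuc (fsuc fzero)) ()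

third-colour : ∀ h y → y ≢ h → y ≢ rot h → y ≡ rot (rot h)
third-colour fzero               fzero               a _ = ⊥-elim (a refl)
third-colour fzero               (fsuc fzero)        _ b = ⊥-elim (b refl)
third-colour fzero               (fsuc (fsuc fzero)) _ _ = refl
third-colour (fsuc fzero)        fzero               _ _ = refl
third-colour (fsuc fzero)        (fsuc fzero)        a _ = ⊥-elim (a refl)
third-colour (fsuc fzero)        (fsuc (fsuc fzero)) _ b = ⊥-elim (b refl)
third-colour (fsuc (fsuc fzero)) fzero               _ b = ⊥-elim (b refl)
third-colour (fsuc (fsuc fzero)) (fsuc fzero)        _ _ = refl
third-colour (fsuc (fsuc fzero)) (fsuc (fsuc fzero)) a _ = ⊥-elim (a refl)

follows : Fin 3 → Fin 3 → Bool
follows h y = does (y FinP.≟ rot h)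

follows-≢ : ∀ h y y' → y ≢ h → y' ≢ h → y ≢ y' → follows h y ≢ follows h y'
follows-≢ h y y' yh y'h yy' with y FinP.≟ rot h | y' FinP.≟ rot h
... | yes e | yes e' = ⊥-elim (yy' (trans e (sym e')))
... | yes _ | no _   = λ ()
... | no _  | yes _  = λ ()
... | no n  | no n'  = ⊥-elim (yy' (trans (third-colour h y yh n) (sym (third-colour h y' y'h n'))))

record OddWheel (G : Graph) {p : ℕ} (C : OddCycle p) : Set where
  open Graph G
  open OddCycle C
  field
    hub       : V
    rim       : Fin p → V
    hub≢rim   : ∀ k → hub ≢ rim k
    rim≢next  : ∀ k → rim k ≢ rim (next k)
    rim≢next² : ∀ k → rim k ≢ rim (next (next k))
    spoke     : ∀ k → E hub (rim k)
    rimEdge   : ∀ k → E (rim k) (rim (next k))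
    noChord   : ∀ k → ¬ E (rim k) (rim (next (next k)))

module _ {G : Graph} {p : ℕ} {C : OddCycle p} (W : OddWheel G C) where
  open Graph G
  open OddCycle C
  open OddWheel W
  open Alternation _≟V_
  open Triples _≟V_

  -- the rim would be 2-coloured by "follows the colour of the hub"
  oddWheel-not-3-colourable : ¬ ThreeColorable G
  oddWheel-not-3-colourable (c , proper) =
    not-bipartite (λ k → follows (c hub) (c (rim k))) λ k →
      follows-≢ (c hub) _ _ (≢-sym (proper _ _ (spoke k))) (≢-sym (proper _ _ (spoke (next k))))
                (proper _ _ (rimEdge k))

  -- the rim would be 2-coloured by the orientations of its triangles
  oddWheel-not-word-representable : ¬ WordRepresentable G
  oddWheel-not-word-representable (w , _ , rep) = not-bipartite (λ k → isClockwise (o k)) flip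
    where
    adjacent⇒alternating : ∀ {x y} → x ≢ y → E x y → Alternating w x y
    adjacent⇒alternating ne e = Equivalence.to (noRepeatAdj⇔ _) (Equivalence.from (rep _ _ ne) e)

    nonadjacent⇒¬alternating : ∀ {x y} → x ≢ y → ¬ E x y → ¬ Alternating w x y
    nonadjacent⇒¬alternating ne ¬e a = ¬e (Equivalence.to (rep _ _ ne) (Equivalence.from (noRepeatAdj⇔ _) a))

    o : ∀ k → Orientation w hub (rim k) (rim (next k))
    o k = orientation w hub (rim k) (rim (next k)) (rim (next (next k)))
            (hub≢rim k) (hub≢rim (next k)) (hub≢rim (next (next k)))
            (rim≢next k) (rim≢next² k) (rim≢next (next k))
            (adjacent⇒alternating (hub≢rim k) (spoke k))
            (adjacent⇒alternating (hub≢rim (next k)) (spoke (next k)))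
            (adjacent⇒alternating (rim≢next k) (rimEdge k))

    flip : ∀ k → isClockwise (o k) ≢ isClockwise (o (next k))
    flip k = orientation-flips w hub (rim k) (rim (next k)) (rim (next (next k)))
               (hub≢rim k) (hub≢rim (next k)) (hub≢rim (next (next k)))
               (rim≢next k) (rim≢next² k) (rim≢next (next k)) (o k) (o (next k))
               (nonadjacent⇒¬alternating (rim≢next² k) (noChord k))

-- Adjacency of (i , j) and
-- (i' , j') depends only on the coordinate differences, classified as
-- i' = i - 1, i' = i, i' = i + 1 or |i' - i| ≥ 2, and, for diagonal
-- neighbours, on the diagonal chosen in the unit square between them.

data Step : Set where
  back same fwd far : Step

step : ℕ → ℕ → Step
step (suc x)       (suc y)       = step x y
step zero          zero          = same
step zero          (suc zero)    = fwd
step (suc zero)    zero          = back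
step zero          (suc (suc _)) = far
step (suc (suc _)) zero          = far

reverse : Step → Step
reverse back = fwd
reverse fwd  = back
reverse same = same
reverse far  = far

step-reverse : ∀ x y → step y x ≡ reverse (step x y)
step-reverse (suc x)       (suc y)       = step-reverse x y
step-reverse zero          zero          = refl
step-reverse zero          (suc zero)    = refl
step-reverse (suc zero)    zero          = refl
step-reverse zero          (suc (suc _)) = refl
step-reverse (suc (suc _)) zero          = refl

step-shift : ∀ x y a → step (x + a) (y + a) ≡ step x y
step-shift x y zero    rewrite +-identityʳ x | +-identityʳ y = refl
step-shift x y (suc a) rewrite +-suc x a | +-suc y a = step-shift x y a

step-same : ∀ x → step x x ≡ same
step-same zero    = refl
step-same (suc x) = step-same x

step-fwd : ∀ x → step x (suc x) ≡ fwd
step-fwd zero    = refl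
step-fwd (suc x) = step-fwd x

step-back : ∀ x → step (suc x) x ≡ back
step-back x = trans (step-reverse x (suc x)) (cong reverse (step-fwd x))

same⇒≡ : ∀ x y → step x y ≡ same → y ≡ x
same⇒≡ (suc x) (suc y) e = cong suc (same⇒≡ x y e)
same⇒≡ zero    zero    e = refl
same⇒≡ zero    (suc zero) ()
same⇒≡ (suc zero) zero ()
same⇒≡ zero (suc (suc _)) ()
same⇒≡ (suc (suc _)) zero ()

fwd⇒≡ : ∀ x y → step x y ≡ fwd → y ≡ suc x
fwd⇒≡ (suc x) (suc y) e = cong suc (fwd⇒≡ x y e)
fwd⇒≡ zero (suc zero) e = refl
fwd⇒≡ zero zero ()
fwd⇒≡ (suc zero) zero ()
fwd⇒≡ zero (suc (suc _)) ()
fwd⇒≡ (suc (suc _)) zero ()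

back⇒≡ : ∀ x y → step x y ≡ back → x ≡ suc y
back⇒≡ x y e = fwd⇒≡ y x (trans (step-reverse x y) (cong reverse e))

far⇒apart : ∀ x y → step x y ≡ far → 2 + x ≤ y ⊎ 2 + y ≤ x
far⇒apart (suc x) (suc y) e with far⇒apart x y e
... | inj₁ h = inj₁ (s≤s h)
... | inj₂ h = inj₂ (s≤s h)
far⇒apart zero (suc (suc y)) _ = inj₁ (s≤s (s≤s z≤n))
far⇒apart (suc (suc x)) zero _ = inj₂ (s≤s (s≤s z≤n))
far⇒apart zero zero ()
far⇒apart zero (suc zero) ()
far⇒apart (suc zero) zero ()

-- Adjacency given the diagonal function e : e a b = true iff the
-- square with lower-left corner (a , b) carries the diagonal
-- (a , b)–(a+1 , b+1).  The steps are those from (i , j) to (i' , j').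
adjacencyTable : (ℕ → ℕ → Bool) → ℕ → ℕ → ℕ → ℕ → Step → Step → Bool
adjacencyTable e i j i' j' same fwd  = true
adjacencyTable e i j i' j' same back = true
adjacencyTable e i j i' j' fwd  same = true
adjacencyTable e i j i' j' back same = true
adjacencyTable e i j i' j' fwd  fwd  = e i j
adjacencyTable e i j i' j' back back = e i' j'
adjacencyTable e i j i' j' fwd  back = not (e i j')
adjacencyTable e i j i' j' back fwd  = not (e i' j)
adjacencyTable e i j i' j' _    _    = false

adjacentB : (ℕ → ℕ → Bool) → ℕ × ℕ → ℕ × ℕ → Bool
adjacentB e (i , j) (i' , j') = adjacencyTable e i j i' j' (step i i') (step j j')

adjacentB-sym : ∀ e p q → adjacentB e p q ≡ adjacentB e q p
adjacentB-sym e (i , j) (i' , j') rewrite step-reverse i i' | step-reverse j j'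
  with step i i' | step j j'
... | back | back = refl
... | back | same = refl
... | back | fwd  = refl
... | back | far  = refl
... | same | back = refl
... | same | same = refl
... | same | fwd  = refl
... | same | far  = refl
... | fwd  | back = refl
... | fwd  | same = refl
... | fwd  | fwd  = refl
... | fwd  | far  = refl
... | far  | back = refl
... | far  | same = refl
... | far  | fwd  = refl
... | far  | far  = refl

-- the diagonal function of a triangulation, extended by false outside
-- the rectangle; kept abstract, it is only used through diagAt-inside
abstract
  diagAt : ∀ {m n} → Triangulation m n → ℕ → ℕ → Bool
  diagAt {m} {n} d a b with a <? m | b <? n
  ... | yes p | yes q = d (fromℕ< p) (fromℕ< q)
  ... | _     | _     = false

  diagAt-inside : ∀ {m n} (d : Triangulation m n) a b (p : a < m) (q : b < n) →
                  diagAt d a b ≡ d (fromℕ< p) (fromℕ< q)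
  diagAt-inside {m} {n} d a b p q with a <? m | b <? n
  ... | yes _ | yes _  = refl
  ... | no ¬p | _      = ⊥-elim (¬p p)
  ... | yes _ | no ¬q  = ⊥-elim (¬q q)

diagAt-fin : ∀ {m n} (d : Triangulation m n) a b → diagAt d (toℕ a) (toℕ b) ≡ d a b
diagAt-fin d a b = trans (diagAt-inside d (toℕ a) (toℕ b) (FinP.toℕ<n a) (FinP.toℕ<n b))
                         (cong₂ d (FinP.fromℕ<-toℕ a (FinP.toℕ<n a)) (FinP.fromℕ<-toℕ b (FinP.toℕ<n b)))

toℕ≤ : ∀ {k} (x : Fin (suc k)) → toℕ x ≤ k
toℕ≤ x = ≤-pred (FinP.toℕ<n x)

module GridAdjacency {m n : ℕ} (d : Triangulation m n) where

  e : ℕ → ℕ → Bool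
  e = diagAt d

  arc⇒adjacent : ∀ {p q} → GridArc m n d p q → adjacentB e p q ≡ true
  arc⇒adjacent (side₁ {i} {j} _ _) rewrite step-same i | step-fwd j = refl
  arc⇒adjacent (side₂ {i} {j} _ _) rewrite step-same j | step-fwd i = refl
  arc⇒adjacent (diag₁ a b eq) rewrite step-fwd (toℕ a) | step-fwd (toℕ b) = trans (diagAt-fin d a b) eq
  arc⇒adjacent (diag₂ a b eq) rewrite step-fwd (toℕ b) | step-back (toℕ a) =
    cong not (trans (diagAt-fin d a b) eq)

  diag₁' : ∀ i j → i < m → j < n → e i j ≡ true → GridArc m n d (i , j) (suc i , suc j)
  diag₁' i j p q eq = subst₂ (λ a b → GridArc m n d (a , b) (suc a , suc b))
                        (FinP.toℕ-fromℕ< p) (FinP.toℕ-fromℕ< q)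
                        (diag₁ (fromℕ< p) (fromℕ< q) (trans (sym (diagAt-inside d i j p q)) eq))

  diag₂' : ∀ i j → i < m → j < n → not (e i j) ≡ true → GridArc m n d (suc i , j) (i , suc j)
  diag₂' i j p q eq = subst₂ (λ a b → GridArc m n d (suc a , b) (a , suc b))
                        (FinP.toℕ-fromℕ< p) (FinP.toℕ-fromℕ< q)
                        (diag₂ (fromℕ< p) (fromℕ< q) (trans (sym (diagAt-inside d i j p q)) (not-true eq)))
    where
    not-true : ∀ {b} → not b ≡ true → b ≡ false
    not-true {false} _ = refl

  adjacent⇒arc : ∀ i j i' j' → i ≤ m → j ≤ n → i' ≤ m → j' ≤ n → adjacentB e (i , j) (i' , j') ≡ true →
                 GridArc m n d (i , j) (i' , j') ⊎ GridArc m n d (i' , j') (i , j)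
  adjacent⇒arc i j i' j' hi hj hi' hj' h with step i i' in si | step j j' in sj
  ... | same | fwd  rewrite same⇒≡ i i' si | fwd⇒≡ j j' sj  = inj₁ (side₁ hi hj')
  ... | same | back rewrite same⇒≡ i i' si | back⇒≡ j j' sj = inj₂ (side₁ hi hj)
  ... | fwd  | same rewrite same⇒≡ j j' sj | fwd⇒≡ i i' si  = inj₁ (side₂ hi' hj)
  ... | back | same rewrite same⇒≡ j j' sj | back⇒≡ i i' si = inj₂ (side₂ hi hj)
  ... | fwd  | fwd  rewrite fwd⇒≡ i i' si  | fwd⇒≡ j j' sj  = inj₁ (diag₁' i j hi' hj' h)
  ... | back | back rewrite back⇒≡ i i' si | back⇒≡ j j' sj = inj₂ (diag₁' i' j' hi hj h)
  ... | fwd  | back rewrite fwd⇒≡ i i' si  | back⇒≡ j j' sj = inj₂ (diag₂' i j' hi' hj h)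
  ... | back | fwd  rewrite back⇒≡ i i' si | fwd⇒≡ j j' sj  = inj₁ (diag₂' i' j hi hj' h)

  edge⇔adjacent : ∀ u v → GridEdge m n d u v ⇔ (adjacentB e (coords u) (coords v) ≡ true)
  edge⇔adjacent u v = mk⇔ to from
    where
    to : GridEdge m n d u v → adjacentB e (coords u) (coords v) ≡ true
    to (inj₁ a) = arc⇒adjacent a
    to (inj₂ a) = trans (adjacentB-sym e (coords u) (coords v)) (arc⇒adjacent a)
    from : adjacentB e (coords u) (coords v) ≡ true → GridEdge m n d u v
    from = adjacent⇒arc _ _ _ _ (toℕ≤ (proj₁ u)) (toℕ≤ (proj₂ u)) (toℕ≤ (proj₁ v)) (toℕ≤ (proj₂ v))

-- The interior vertex (a+1 , b+1) has degree 4
-- plus the number of the four surrounding diagonals ending in it, so its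
-- degree is odd iff `oddDegree e a b`.  Its neighbourhood is then an odd
-- wheel W₅ or W₇, which is checked on the 3 × 3 block around it.

oddDegree : (ℕ → ℕ → Bool) → ℕ → ℕ → Bool
oddDegree e a b = e a b xor (e (suc a) b xor (e a (suc b) xor e (suc a) (suc b)))

blockDiag : Bool → Bool → Bool → Bool → ℕ → ℕ → Bool
blockDiag v₀₀ v₁₀ v₀₁ v₁₁ 0 0 = v₀₀
blockDiag v₀₀ v₁₀ v₀₁ v₁₁ 1 0 = v₁₀
blockDiag v₀₀ v₁₀ v₀₁ v₁₁ 0 1 = v₀₁
blockDiag v₀₀ v₁₀ v₀₁ v₁₁ 1 1 = v₁₁
blockDiag v₀₀ v₁₀ v₀₁ v₁₁ _ _ = false

Cell : Set
Cell = Fin 3 × Fin 3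

_≟Cell_ : DecidableEquality Cell
_≟Cell_ = ≡-dec FinP._≟_ FinP._≟_

centre : Cell
centre = # 1 , # 1

cellAdjacent : (ℕ → ℕ → Bool) → Cell → Cell → Bool
cellAdjacent ℓ (p , q) (p' , q') = adjacentB ℓ (toℕ p , toℕ q) (toℕ p' , toℕ q')

cellDistinct : Cell → Cell → Bool
cellDistinct P P' = not (does (P ≟Cell P'))

rimCheck : (ℕ → ℕ → Bool) → Cell → Cell → Cell → Bool
rimCheck ℓ r r₁ r₂ = cellAdjacent ℓ centre r ∧ cellAdjacent ℓ r r₁ ∧ not (cellAdjacent ℓ r r₂)
                   ∧ cellDistinct centre r ∧ cellDistinct r r₁ ∧ cellDistinct r r₂

record RimFacts (ℓ : ℕ → ℕ → Bool) (r r₁ r₂ : Cell) : Set where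
  field
    centre~r  : T (cellAdjacent ℓ centre r)
    r~r₁      : T (cellAdjacent ℓ r r₁)
    r≁r₂      : T (not (cellAdjacent ℓ r r₂))
    centre≢r  : T (cellDistinct centre r)
    r≢r₁      : T (cellDistinct r r₁)
    r≢r₂      : T (cellDistinct r r₂)

rimFacts : ∀ ℓ r r₁ r₂ → T (rimCheck ℓ r r₁ r₂) → RimFacts ℓ r r₁ r₂
rimFacts ℓ r r₁ r₂ h =
  let (h₁ , h) = Equivalence.to T-∧ h ; (h₂ , h) = Equivalence.to T-∧ h ; (h₃ , h) = Equivalence.to T-∧ h
      (h₄ , h) = Equivalence.to T-∧ h ; (h₅ , h₆) = Equivalence.to T-∧ h
  in record { centre~r = h₁ ; r~r₁ = h₂ ; r≁r₂ = h₃ ; centre≢r = h₄ ; r≢r₁ = h₅ ; r≢r₂ = h₆ }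

every : ∀ {p} → (Fin p → Bool) → Bool
every {zero}  f = true
every {suc p} f = f fzero ∧ every (λ k → f (fsuc k))

every-sound : ∀ {p} (f : Fin p → Bool) → T (every f) → ∀ k → T (f k)
every-sound {suc p} f h fzero    = proj₁ (Equivalence.to T-∧ h)
every-sound {suc p} f h (fsuc k) = every-sound (λ k → f (fsuc k)) (proj₂ (Equivalence.to T-∧ h)) k

record BlockWheel (ℓ : ℕ → ℕ → Bool) : Set where
  field
    size  : ℕ
    cycle : OddCycle size
    rim   : Vec Cell size
  open OddCycle cycle
  field
    valid : T (every λ k → rimCheck ℓ (lookup rim k) (lookup rim (next k)) (lookup rim (next (next k))))

-- the rim lists the neighbours of the centre in cyclic order
blockWheel : ∀ v₀₀ v₁₀ v₀₁ v₁₁ → oddDegree (blockDiag v₀₀ v₁₀ v₀₁ v₁₁) 0 0 ≡ true →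
             BlockWheel (blockDiag v₀₀ v₁₀ v₀₁ v₁₁)
blockWheel false false false true  _ = record { cycle = cycle7 ; valid = tt ; rim =
  (# 2 , # 1) ∷ (# 2 , # 2) ∷ (# 1 , # 2) ∷ (# 0 , # 2) ∷ (# 0 , # 1) ∷ (# 1 , # 0) ∷ (# 2 , # 0) ∷ [] }
blockWheel false false true  false _ = record { cycle = cycle5 ; valid = tt ; rim =
  (# 2 , # 1) ∷ (# 1 , # 2) ∷ (# 0 , # 1) ∷ (# 1 , # 0) ∷ (# 2 , # 0) ∷ [] }
blockWheel false true  false false _ = record { cycle = cycle5 ; valid = tt ; rim =
  (# 2 , # 1) ∷ (# 1 , # 2) ∷ (# 0 , # 2) ∷ (# 0 , # 1) ∷ (# 1 , # 0) ∷ [] }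
blockWheel false true  true  true  _ = record { cycle = cycle5 ; valid = tt ; rim =
  (# 2 , # 1) ∷ (# 2 , # 2) ∷ (# 1 , # 2) ∷ (# 0 , # 1) ∷ (# 1 , # 0) ∷ [] }
blockWheel true  false false false _ = record { cycle = cycle7 ; valid = tt ; rim =
  (# 2 , # 1) ∷ (# 1 , # 2) ∷ (# 0 , # 2) ∷ (# 0 , # 1) ∷ (# 0 , # 0) ∷ (# 1 , # 0) ∷ (# 2 , # 0) ∷ [] }
blockWheel true  false true  true  _ = record { cycle = cycle7 ; valid = tt ; rim =
  (# 2 , # 1) ∷ (# 2 , # 2) ∷ (# 1 , # 2) ∷ (# 0 , # 1) ∷ (# 0 , # 0) ∷ (# 1 , # 0) ∷ (# 2 , # 0) ∷ [] }
blockWheel true  true  false true  _ = record { cycle = cycle7 ; valid = tt ; rim =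
  (# 2 , # 1) ∷ (# 2 , # 2) ∷ (# 1 , # 2) ∷ (# 0 , # 2) ∷ (# 0 , # 1) ∷ (# 0 , # 0) ∷ (# 1 , # 0) ∷ [] }
blockWheel true  true  true  false _ = record { cycle = cycle5 ; valid = tt ; rim =
  (# 2 , # 1) ∷ (# 1 , # 2) ∷ (# 0 , # 1) ∷ (# 0 , # 0) ∷ (# 1 , # 0) ∷ [] }

-- Adjacency only reads the diagonals of the squares between the two
-- vertices, so inside a 3 × 3 block it is determined by the four
-- diagonals of the block.
adjacentB-block : ∀ (E E' : ℕ → ℕ → Bool) a b → (∀ x y → x ≤ 1 → y ≤ 1 → E (x + a) (y + b) ≡ E' x y) →
                  ∀ p q p' q' → p ≤ 2 → q ≤ 2 → p' ≤ 2 → q' ≤ 2 →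
                  adjacentB E (p + a , q + b) (p' + a , q' + b) ≡ adjacentB E' (p , q) (p' , q')
adjacentB-block E E' a b agree p q p' q' hp hq hp' hq'
  rewrite step-shift p p' a | step-shift q q' b with step p p' in sp | step q q' in sq
... | fwd  | fwd  rewrite fwd⇒≡ p p' sp  | fwd⇒≡ q q' sq  = agree p q (≤-pred hp') (≤-pred hq')
... | back | back rewrite back⇒≡ p p' sp | back⇒≡ q q' sq = agree p' q' (≤-pred hp) (≤-pred hq)
... | fwd  | back rewrite fwd⇒≡ p p' sp  | back⇒≡ q q' sq = cong not (agree p q' (≤-pred hp') (≤-pred hq))
... | back | fwd  rewrite back⇒≡ p p' sp | fwd⇒≡ q q' sq  = cong not (agree p' q (≤-pred hp) (≤-pred hq'))
... | back | same = refl
... | back | far  = refl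
... | same | back = refl
... | same | same = refl
... | same | fwd  = refl
... | same | far  = refl
... | fwd  | same = refl
... | fwd  | far  = refl
... | far  | back = refl
... | far  | same = refl
... | far  | fwd  = refl
... | far  | far  = refl

module Block {m n : ℕ} (d : Triangulation m n) (a b : ℕ) (2+a≤m : 2 + a ≤ m) (2+b≤n : 2 + b ≤ n) where
  open GridAdjacency d

  ℓ : ℕ → ℕ → Bool
  ℓ = blockDiag (e a b) (e (suc a) b) (e a (suc b)) (e (suc a) (suc b))

  inside : ∀ {a k} → 2 + a ≤ k → (p : Fin 3) → toℕ p + a < suc k
  inside {a} h p = s≤s (≤-trans (+-monoˡ-≤ a (toℕ≤ p)) h)

  loc : Cell → GridVertex m n
  loc (p , q) = fromℕ< (inside 2+a≤m p) , fromℕ< (inside 2+b≤n q)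

  coords-loc : ∀ p q → coords (loc (p , q)) ≡ (toℕ p + a , toℕ q + b)
  coords-loc p q = cong₂ _,_ (FinP.toℕ-fromℕ< (inside 2+a≤m p)) (FinP.toℕ-fromℕ< (inside 2+b≤n q))

  loc-injective : ∀ P P' → loc P ≡ loc P' → P ≡ P'
  loc-injective (p , q) (p' , q') eq = cong₂ _,_
    (FinP.toℕ-injective (+-cancelʳ-≡ _ _ _ (cong proj₁ (trans (sym (coords-loc p q)) (trans (cong coords eq) (coords-loc p' q'))))))
    (FinP.toℕ-injective (+-cancelʳ-≡ _ _ _ (cong proj₂ (trans (sym (coords-loc p q)) (trans (cong coords eq) (coords-loc p' q'))))))

  agree : ∀ x y → x ≤ 1 → y ≤ 1 → e (x + a) (y + b) ≡ ℓ x y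
  agree 0 0 _ _ = refl
  agree 1 0 _ _ = refl
  agree 0 1 _ _ = refl
  agree 1 1 _ _ = refl
  agree (suc (suc x)) _ (s≤s ()) _
  agree _ (suc (suc y)) _ (s≤s ())

  block-adjacency : ∀ P P' → adjacentB e (coords (loc P)) (coords (loc P')) ≡ cellAdjacent ℓ P P'
  block-adjacency (p , q) (p' , q') = trans (cong₂ (adjacentB e) (coords-loc p q) (coords-loc p' q'))
    (adjacentB-block e ℓ a b agree (toℕ p) (toℕ q) (toℕ p') (toℕ q') (toℕ≤ p) (toℕ≤ q) (toℕ≤ p') (toℕ≤ q'))

  edge : ∀ P P' → T (cellAdjacent ℓ P P') → GridEdge m n d (loc P) (loc P')
  edge P P' h = Equivalence.from (edge⇔adjacent (loc P) (loc P')) (trans (block-adjacency P P') (Equivalence.to T-≡ h))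

  nonEdge : ∀ P P' → T (not (cellAdjacent ℓ P P')) → ¬ GridEdge m n d (loc P) (loc P')
  nonEdge P P' h E = false≢true (trans (sym (Equivalence.to T-not-≡ h))
    (trans (sym (block-adjacency P P')) (Equivalence.to (edge⇔adjacent (loc P) (loc P')) E)))

  distinct : ∀ P P' → T (cellDistinct P P') → loc P ≢ loc P'
  distinct P P' h eq with P ≟Cell P'
  ... | no ne = ne (loc-injective P P' eq)

  oddWheel : (W : BlockWheel ℓ) → OddWheel (TriangulatedGrid m n d) (BlockWheel.cycle W)
  oddWheel W = record
    { hub       = loc centre
    ; rim       = λ k → loc (r k)
    ; hub≢rim   = λ k → distinct _ _ (RimFacts.centre≢r (facts k))
    ; rim≢next  = λ k → distinct _ _ (RimFacts.r≢r₁ (facts k))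
    ; rim≢next² = λ k → distinct _ _ (RimFacts.r≢r₂ (facts k))
    ; spoke     = λ k → edge _ _ (RimFacts.centre~r (facts k))
    ; rimEdge   = λ k → edge _ _ (RimFacts.r~r₁ (facts k))
    ; noChord   = λ k → nonEdge _ _ (RimFacts.r≁r₂ (facts k))
    }
    where
    open BlockWheel W
    open OddCycle cycle
    r : Fin size → Cell
    r = lookup rim
    facts : ∀ k → RimFacts ℓ (r k) (r (next k)) (r (next (next k)))
    facts k = rimFacts ℓ _ _ _ (every-sound _ valid k)

oddVertex-obstruction : ∀ {m n} (d : Triangulation m n) a b → 2 + a ≤ m → 2 + b ≤ n →
                        oddDegree (diagAt d) a b ≡ true →
                        ¬ WordRepresentable (TriangulatedGrid m n d) × ¬ ThreeColorable (TriangulatedGrid m n d)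
oddVertex-obstruction d a b 2+a≤m 2+b≤n odd =
  oddWheel-not-word-representable W , oddWheel-not-3-colourable W
  where
  open Block d a b 2+a≤m 2+b≤n
  W = oddWheel (blockWheel _ _ _ _ odd)

parity : ℕ → Bool
parity zero    = false
parity (suc k) = not (parity k)

parity-pred : ∀ x → 1 ≤ x → parity (pred x) ≡ not (parity x)
parity-pred (suc x) _ = sym (not-involutive (parity x))

xor-cancelˡ : ∀ x {y z} → x xor y ≡ x xor z → y ≡ z
xor-cancelˡ false e = e
xor-cancelˡ true  e = not-injective e

-- Heights.  A walk starting at s that moves up at step i when f i holds
-- and down otherwise; while i ≤ s it never needs to go below 0.
module Walk (f : ℕ → Bool) (s : ℕ) where

  height : ℕ → ℕ
  height zero    = s
  height (suc i) = if f i then suc (height i) else pred (height i)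

  height-≤ : ∀ i → height i ≤ s + i
  height-≤ zero = ≤-reflexive (sym (+-identityʳ s))
  height-≤ (suc i) with f i
  ... | true  = ≤-trans (s≤s (height-≤ i)) (≤-reflexive (sym (+-suc s i)))
  ... | false = ≤-trans pred[n]≤n (≤-trans (height-≤ i) (+-monoʳ-≤ s (n≤1+n i)))

  height-≥ : ∀ i → i ≤ s → s ≤ height i + i
  height-≥ zero _ = ≤-reflexive (sym (+-identityʳ s))
  height-≥ (suc i) le with f i | height-≥ i (≤-trans (n≤1+n i) le)
  ... | true  | h = ≤-trans h (m≤n⇒m≤1+n (+-monoʳ-≤ (height i) (n≤1+n i)))
  ... | false | h with height i
  ...   | zero   = ⊥-elim (<⇒≱ le h)
  ...   | suc h' = ≤-trans h (≤-reflexive (sym (+-suc h' i)))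

  height-pos : ∀ i → i < s → 1 ≤ height i
  height-pos i lt with height i | height-≥ i (<⇒≤ lt)
  ... | zero  | h = ⊥-elim (<⇒≱ lt h)
  ... | suc _ | _ = s≤s z≤n

  height-up : ∀ i → f i ≡ true → height (suc i) ≡ suc (height i)
  height-up i h rewrite h = refl

  height-down : ∀ i → i < s → f i ≡ false → height i ≡ suc (height (suc i))
  height-down i lt h rewrite h with height i | height-pos i lt
  ... | suc _ | _ = refl

  height-parity : ∀ i → i ≤ s → parity (height i) ≡ parity s xor parity i
  height-parity zero _ = sym (xor-identityʳ (parity s))
  height-parity (suc i) le with f i | height-parity i (≤-trans (n≤1+n i) le)
  ... | true  | ih = trans (cong not ih) (not-distribʳ-xor (parity s) (parity i))
  ... | false | ih = trans (parity-pred (height i) (height-pos i le))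
                       (trans (cong not ih) (not-distribʳ-xor (parity s) (parity i)))

  consecutive-heights : ∀ i i' → i ≤ s → i' ≤ s → height i' ≡ suc (height i) → parity i' ≡ not (parity i)
  consecutive-heights i i' hi hi' eq = xor-cancelˡ (parity s)
    (trans (sym (height-parity i' hi'))
      (trans (cong parity eq) (trans (cong not (height-parity i hi)) (not-distribʳ-xor (parity s) (parity i)))))

xor-solve : ∀ w x y z → w xor (x xor (y xor z)) ≡ false → z ≡ w xor (x xor y)
xor-solve false false false false _ = refl
xor-solve false false true  true  _ = refl
xor-solve false true  false true  _ = refl
xor-solve false true  true  false _ = refl
xor-solve true  false false true  _ = refl
xor-solve true  false true  false _ = refl
xor-solve true  true  false false _ = refl
xor-solve true  true  true  true  _ = refl

split-corner : ∀ x y → not ((x xor y) xor not y) ≡ x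
split-corner false false = refl
split-corner false true  = refl
split-corner true  false = refl
split-corner true  true  = refl

split-step : ∀ f f' g g' → not (f xor g) xor (not (f' xor g) xor not (f xor g')) ≡ not (f' xor g')
split-step false false false false = refl
split-step false false false true  = refl
split-step false false true  false = refl
split-step false false true  true  = refl
split-step false true  false false = refl
split-step false true  false true  = refl
split-step false true  true  false = refl
split-step false true  true  true  = refl
split-step true  false false false = refl
split-step true  false false true  = refl
split-step true  false true  false = refl
split-step true  false true  true  = refl
split-step true  true  false false = refl
split-step true  true  false true  = refl
split-step true  true  true  false = refl
split-step true  true  true  true  = refl

true-or-false : ∀ b → b ≡ true ⊎ b ≡ false
true-or-false true  = inj₁ refl
true-or-false false = inj₂ refl

not≡true : ∀ {x} → not x ≡ true → x ≡ false
not≡true {false} _ = refl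

not≡false : ∀ {x} → not x ≡ false → x ≡ true
not≡false {true} _ = refl

xor≡false : ∀ x y → x xor y ≡ false → y ≡ x
xor≡false false false _ = refl
xor≡false true  true  _ = refl

xor≡true : ∀ x y → x xor y ≡ true → y ≡ not x
xor≡true false true  _ = refl
xor≡true true  false _ = refl

module Even {m n : ℕ} (d : Triangulation m n)
            (even : ∀ a b → 2 + a ≤ m → 2 + b ≤ n → oddDegree (diagAt d) a b ≡ false) where
  open GridAdjacency d public

  -- whether the heights go up along row step a and column step b
  rowUp colUp : ℕ → Bool
  rowUp a = e a 0 xor e 0 0
  colUp b = not (e 0 b)

  -- the square (a , b) has the diagonal (a , b)–(a+1 , b+1) iff the
  -- row and column heights move in the same direction across it
  diagonal-split : ∀ a b → a < m → b < n → e a b ≡ not (rowUp a xor colUp b)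
  diagonal-split zero b _ _ =
    sym (trans (cong (λ x → not (x xor colUp b)) (xor-same (e 0 0))) (not-involutive (e 0 b)))
  diagonal-split (suc a) zero _ _ = sym (split-corner (e (suc a) 0) (e 0 0))
  diagonal-split (suc a) (suc b) a<m b<n =
    trans (xor-solve (e a b) (e (suc a) b) (e a (suc b)) (e (suc a) (suc b)) (even a b a<m b<n))
      (trans (cong₂ _xor_ (diagonal-split a b (<-trans (n<1+n a) a<m) (<-trans (n<1+n b) b<n))
               (cong₂ _xor_ (diagonal-split (suc a) b a<m (<-trans (n<1+n b) b<n))
                            (diagonal-split a (suc b) (<-trans (n<1+n a) a<m) b<n)))
             (split-step (rowUp a) (rowUp (suc a)) (colUp b) (colUp (suc b))))

  module R = Walk rowUp m
  module C = Walk colUp n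

  P Q : ℕ → ℕ
  P = R.height
  Q = C.height

  record Precedes (i j i' j' : ℕ) : Set where
    field
      P≤P'   : P i ≤ P i'
      P'≤1+P : P i' ≤ suc (P i)
      Q≤Q'   : Q j ≤ Q j'
      Q'≤1+Q : Q j' ≤ suc (Q j)
      S<S'   : P i + Q j < P i' + Q j'
      i≤1+i' : i ≤ suc i'
      i'≤1+i : i' ≤ suc i
      j≤1+j' : j ≤ suc j'
      j'≤1+j : j' ≤ suc j

  precedes : ∀ {i j i' j'} δP δQ → P i' ≡ δP + P i → Q j' ≡ δQ + Q j → δP ≤ 1 → δQ ≤ 1 → 1 ≤ δP + δQ →
             i ≤ suc i' → i' ≤ suc i → j ≤ suc j' → j' ≤ suc j → Precedes i j i' j'
  precedes {i} {j} {i'} {j'} δP δQ eP eQ hP hQ pos a b c d' = record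
    { P≤P' = subst (P i ≤_) (sym eP) (m≤n+m (P i) δP)
    ; P'≤1+P = subst (_≤ suc (P i)) (sym eP) (+-monoˡ-≤ (P i) hP)
    ; Q≤Q' = subst (Q j ≤_) (sym eQ) (m≤n+m (Q j) δQ)
    ; Q'≤1+Q = subst (_≤ suc (Q j)) (sym eQ) (+-monoˡ-≤ (Q j) hQ)
    ; S<S' = subst₂ (λ x y → P i + Q j < x + y) (sym eP) (sym eQ) (S-grows δP δQ (P i) (Q j) pos)
    ; i≤1+i' = a ; i'≤1+i = b ; j≤1+j' = c ; j'≤1+j = d' }
    where
    S-grows : ∀ δP δQ x y → 1 ≤ δP + δQ → x + y < (δP + x) + (δQ + y)
    S-grows δP δQ x y pos = ≤-trans (+-monoˡ-≤ (x + y) pos)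
      (≤-reflexive (solve 4 (λ a b x y → (a :+ b) :+ (x :+ y) := (a :+ x) :+ (b :+ y)) refl δP δQ x y))

  Move : Bool → ℕ → ℕ → Set
  Move up h h' = (up ≡ true × h' ≡ 1 + h) ⊎ (up ≡ false × h ≡ 1 + h')

  rowMove : ∀ i → i < m → Move (rowUp i) (P i) (P (suc i))
  rowMove i lt with true-or-false (rowUp i)
  ... | inj₁ r = inj₁ (r , R.height-up i r)
  ... | inj₂ r = inj₂ (r , R.height-down i lt r)

  colMove : ∀ j → j < n → Move (colUp j) (Q j) (Q (suc j))
  colMove j lt with true-or-false (colUp j)
  ... | inj₁ c = inj₁ (c , C.height-up j c)
  ... | inj₂ c = inj₂ (c , C.height-down j lt c)

  mainDiag : ∀ i j → i < m → j < n → e i j ≡ true → colUp j ≡ rowUp i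
  mainDiag i j lt lt' h = xor≡false _ _ (not≡true (trans (sym (diagonal-split i j lt lt')) h))

  antiDiag : ∀ i j → i < m → j < n → not (e i j) ≡ true → colUp j ≡ not (rowUp i)
  antiDiag i j lt lt' h = xor≡true _ _ (not≡false (trans (sym (diagonal-split i j lt lt')) (not≡true h)))

  Oriented : ℕ → ℕ → ℕ → ℕ → Set
  Oriented i j i' j' = Precedes i j i' j' ⊎ Precedes i' j' i j

  near : ∀ x → x ≤ suc x
  near = n≤1+n

  near₂ : ∀ x → x ≤ 2 + x
  near₂ x = ≤-trans (n≤1+n x) (n≤1+n (suc x))

  vertical : ∀ i j → j < n → Oriented i j i (suc j)
  vertical i j lt with colMove j lt
  ... | inj₁ (_ , up) = inj₁ (precedes 0 1 refl up z≤n ≤-refl ≤-refl (near i) (near i) (near₂ j) ≤-refl)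
  ... | inj₂ (_ , dn) = inj₂ (precedes 0 1 refl dn z≤n ≤-refl ≤-refl (near i) (near i) ≤-refl (near₂ j))

  horizontal : ∀ i j → i < m → Oriented i j (suc i) j
  horizontal i j lt with rowMove i lt
  ... | inj₁ (_ , up) = inj₁ (precedes 1 0 up refl ≤-refl z≤n ≤-refl (near₂ i) ≤-refl (near j) (near j))
  ... | inj₂ (_ , dn) = inj₂ (precedes 1 0 dn refl ≤-refl z≤n ≤-refl ≤-refl (near₂ i) (near j) (near j))

  diagonal : ∀ i j → i < m → j < n → e i j ≡ true → Oriented i j (suc i) (suc j)
  diagonal i j lt lt' h with rowMove i lt | colMove j lt' | mainDiag i j lt lt' h
  ... | inj₁ (_ , up) | inj₁ (_ , up') | _ =
    inj₁ (precedes 1 1 up up' ≤-refl ≤-refl (s≤s z≤n) (near₂ i) ≤-refl (near₂ j) ≤-refl)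
  ... | inj₂ (_ , dn) | inj₂ (_ , dn') | _ =
    inj₂ (precedes 1 1 dn dn' ≤-refl ≤-refl (s≤s z≤n) ≤-refl (near₂ i) ≤-refl (near₂ j))
  ... | inj₁ (r , _) | inj₂ (c , _) | eq = ⊥-elim (false≢true (trans (sym c) (trans eq r)))
  ... | inj₂ (r , _) | inj₁ (c , _) | eq = ⊥-elim (false≢true (trans (sym r) (trans (sym eq) c)))

  antidiagonal : ∀ i j → i < m → j < n → not (e i j) ≡ true → Oriented (suc i) j i (suc j)
  antidiagonal i j lt lt' h with rowMove i lt | colMove j lt' | antiDiag i j lt lt' h
  ... | inj₂ (_ , dn) | inj₁ (_ , up') | _ =
    inj₁ (precedes 1 1 dn up' ≤-refl ≤-refl (s≤s z≤n) ≤-refl (near₂ i) (near₂ j) ≤-refl)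
  ... | inj₁ (_ , up) | inj₂ (_ , dn') | _ =
    inj₂ (precedes 1 1 up dn' ≤-refl ≤-refl (s≤s z≤n) (near₂ i) ≤-refl ≤-refl (near₂ j))
  ... | inj₁ (r , _) | inj₁ (c , _) | eq = ⊥-elim (false≢true (trans (cong not (sym r)) (trans (sym eq) c)))
  ... | inj₂ (r , _) | inj₂ (c , _) | eq = ⊥-elim (false≢true (trans (sym c) (trans eq (cong not r))))

  flipO : ∀ {i j i' j'} → Oriented i j i' j' → Oriented i' j' i j
  flipO (inj₁ p) = inj₂ p
  flipO (inj₂ p) = inj₁ p

  edge⇒oriented : ∀ u v → GridEdge m n d u v → Oriented (toℕ (proj₁ u)) (toℕ (proj₂ u)) (toℕ (proj₁ v)) (toℕ (proj₂ v))
  edge⇒oriented u v (inj₁ a) = arc a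
    where
    arc : ∀ {p q} → GridArc m n d p q → Oriented (proj₁ p) (proj₂ p) (proj₁ q) (proj₂ q)
    arc (side₁ {i} {j} _ lt) = vertical i j lt
    arc (side₂ {i} {j} lt _) = horizontal i j lt
    arc (diag₁ a b h) = diagonal (toℕ a) (toℕ b) (FinP.toℕ<n a) (FinP.toℕ<n b) (trans (diagAt-fin d a b) h)
    arc (diag₂ a b h) = antidiagonal (toℕ a) (toℕ b) (FinP.toℕ<n a) (FinP.toℕ<n b)
                                     (cong not (trans (diagAt-fin d a b) h))
  edge⇒oriented u v (inj₂ a) = flipO (edge⇒oriented v u (inj₁ a))

  height-sum : GridVertex m n → ℕ
  height-sum (i , j) = P (toℕ i) + Q (toℕ j)

  -- the sum of heights grows by 1 or 2 along every oriented edge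
  precedes-colour : ∀ {i j i' j'} → Precedes i j i' j' → mod3 (P i + Q j) ≢ mod3 (P i' + Q j')
  precedes-colour {i} {j} {i'} {j'} pr = mod3-≢ (S<S')
    (≤-trans (+-mono-≤ P'≤1+P Q'≤1+Q) (≤-reflexive (cong suc (+-suc (P i) (Q j)))))
    where open Precedes pr

  colouring : ThreeColorable (TriangulatedGrid m n d)
  colouring = (λ v → mod3 (height-sum v)) , proper
    where
    proper : ∀ u v → GridEdge m n d u v → mod3 (height-sum u) ≢ mod3 (height-sum v)
    proper u v E with edge⇒oriented u v E
    ... | inj₁ pr = precedes-colour pr
    ... | inj₂ pr = ≢-sym (precedes-colour pr)

does-true : ∀ {A : Set} (a? : Dec A) → does a? ≡ true → A
does-true (yes a) _ = a

opt : {V : Set} → V → Bool → List V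
opt x p = if p then x ∷ [] else []

filter-two : ∀ {V : Set} (f : V → Bool) a b → filter (λ w → T? (f w)) (a ∷ b ∷ []) ≡ opt a (f a) ++ opt b (f b)
filter-two f a b with f a
... | true  = cong (a ∷_) rest
  where
  rest : filter (λ w → T? (f w)) (b ∷ []) ≡ opt b (f b)
  rest with f b
  ... | true  = refl
  ... | false = refl
... | false with f b
...   | true  = refl
...   | false = refl

module TwoBuckets {V : Set} (a b : V) where

  buckets : Bool → Bool → ℕ → ℕ → ℕ → List V
  buckets pa pb ka kb zero    = []
  buckets pa pb ka kb (suc k) =
    (opt a (pa ∧ does (ka ≟ℕ k)) ++ opt b (pb ∧ does (kb ≟ℕ k))) ++ buckets pa pb ka kb k

  pair : Bool → Bool → Bool → List V
  pair true  true  true  = a ∷ b ∷ []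
  pair true  true  false = b ∷ a ∷ []
  pair true  false _     = a ∷ []
  pair false true  _     = b ∷ []
  pair false false _     = []

  pair-step : ∀ α A β B o → (α ≡ true → A ≡ false) → (β ≡ true → B ≡ false) →
              (α ≡ true → B ≡ true → o ≡ true) → (β ≡ true → A ≡ true → o ≡ false) →
              (α ≡ true → β ≡ true → o ≡ true) →
              (opt a α ++ opt b β) ++ pair A B o ≡ pair (α ∨ A) (β ∨ B) o
  pair-step false A false B o _ _ _ _ _ = refl
  pair-step true A false B o hα _ hαB _ _ rewrite hα refl with B
  ... | false = refl
  ... | true  rewrite hαB refl refl = refl
  pair-step false A true B o _ hβ _ hβA _ rewrite hβ refl with A
  ... | false = refl
  ... | true  rewrite hβA refl refl = refl
  pair-step true A true B o hα hβ _ _ hαβ rewrite hα refl | hβ refl | hαβ refl refl = refl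

  <?-suc : ∀ x k → does (x <? suc k) ≡ does (x ≟ℕ k) ∨ does (x <? k)
  <?-suc x k with <-cmp x k
  ... | tri< x<k _ _ = trans (dec-true (x <? suc k) (m<n⇒m<1+n x<k))
                         (sym (trans (cong (_∨ does (x <? k)) (dec-false (x ≟ℕ k) (<⇒≢ x<k)))
                                     (dec-true (x <? k) x<k)))
  ... | tri≈ _ refl _ = trans (dec-true (x <? suc x) (n<1+n x))
                          (sym (cong (_∨ does (x <? x)) (dec-true (x ≟ℕ x) refl)))
  ... | tri> _ _ k<x = trans (dec-false (x <? suc k) (λ h → <⇒≱ k<x (≤-pred h)))
                         (sym (trans (cong (_∨ does (x <? k)) (dec-false (x ≟ℕ k) (≢-sym (<⇒≢ k<x))))
                                     (dec-false (x <? k) (<⇒≯ k<x))))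

  flagged : ∀ {p q} → p ∧ q ≡ true → q ≡ true
  flagged {true} h = h

  buckets≡pair : ∀ pa pb ka kb k →
                 buckets pa pb ka kb k ≡ pair (pa ∧ does (ka <? k)) (pb ∧ does (kb <? k)) (does (kb ≤? ka))
  buckets≡pair pa pb ka kb zero rewrite ∧-zeroʳ pa | ∧-zeroʳ pb = refl
  buckets≡pair pa pb ka kb (suc k) =
    trans (cong ((opt a (pa ∧ does (ka ≟ℕ k)) ++ opt b (pb ∧ does (kb ≟ℕ k))) ++_) (buckets≡pair pa pb ka kb k))
      (trans (pair-step (pa ∧ does (ka ≟ℕ k)) _ (pb ∧ does (kb ≟ℕ k)) _ _ hα hβ hαB hβA hαβ)
             (cong₂ (λ A B → pair A B (does (kb ≤? ka))) (lower pa ka) (lower pb kb)))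
    where
    lower : ∀ p x → (p ∧ does (x ≟ℕ k)) ∨ (p ∧ does (x <? k)) ≡ p ∧ does (x <? suc k)
    lower p x = trans (sym (∧-distribˡ-∨ p _ _)) (cong (p ∧_) (sym (<?-suc x k)))
    eqk : ∀ {p} x → p ∧ does (x ≟ℕ k) ≡ true → x ≡ k
    eqk x h = does-true (x ≟ℕ k) (flagged h)
    ltk : ∀ {p} x → p ∧ does (x <? k) ≡ true → x < k
    ltk x h = does-true (x <? k) (flagged h)
    hα : _ → pa ∧ does (ka <? k) ≡ false
    hα h rewrite eqk ka h = trans (cong (pa ∧_) (dec-false (k <? k) (n≮n k))) (∧-zeroʳ pa)
    hβ : _ → pb ∧ does (kb <? k) ≡ false
    hβ h rewrite eqk kb h = trans (cong (pb ∧_) (dec-false (k <? k) (n≮n k))) (∧-zeroʳ pb)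
    hαB : _ → _ → does (kb ≤? ka) ≡ true
    hαB h h' = dec-true (kb ≤? ka) (subst (kb ≤_) (sym (eqk ka h)) (<⇒≤ (ltk kb h')))
    hβA : _ → _ → does (kb ≤? ka) ≡ false
    hβA h h' = dec-false (kb ≤? ka) (subst (_≰ ka) (sym (eqk kb h)) (<⇒≱ (ltk ka h')))
    hαβ : _ → _ → does (kb ≤? ka) ≡ true
    hαβ h h' = dec-true (kb ≤? ka) (≤-reflexive (trans (eqk kb h') (sym (eqk ka h))))

pair-swap : ∀ {V : Set} (a b : V) p q o → TwoBuckets.pair a b p q o ≡ TwoBuckets.pair b a q p (not o)
pair-swap a b true  true  true  = refl
pair-swap a b true  true  false = refl
pair-swap a b true  false _     = refl
pair-swap a b false true  _     = refl
pair-swap a b false false _     = refl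

filter-comm : ∀ {V : Set} {P Q : V → Set} (P? : ∀ z → Dec (P z)) (Q? : ∀ z → Dec (Q z)) l →
              filter P? (filter Q? l) ≡ filter Q? (filter P? l)
filter-comm P? Q? [] = refl
filter-comm P? Q? (x ∷ l) = by-cases (P? x) (Q? x)
  where
  open ≡-Reasoning
  by-cases : Dec _ → Dec _ → filter P? (filter Q? (x ∷ l)) ≡ filter Q? (filter P? (x ∷ l))
  by-cases (yes p) (yes q) = begin
    filter P? (filter Q? (x ∷ l)) ≡⟨ cong (filter P?) (filter-accept Q? q) ⟩
    filter P? (x ∷ filter Q? l)   ≡⟨ filter-accept P? p ⟩
    x ∷ filter P? (filter Q? l)   ≡⟨ cong (x ∷_) (filter-comm P? Q? l) ⟩
    x ∷ filter Q? (filter P? l)   ≡⟨ sym (filter-accept Q? q) ⟩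
    filter Q? (x ∷ filter P? l)   ≡⟨ cong (filter Q?) (sym (filter-accept P? p)) ⟩
    filter Q? (filter P? (x ∷ l)) ∎
  by-cases (yes p) (no ¬q) = begin
    filter P? (filter Q? (x ∷ l)) ≡⟨ cong (filter P?) (filter-reject Q? ¬q) ⟩
    filter P? (filter Q? l)       ≡⟨ filter-comm P? Q? l ⟩
    filter Q? (filter P? l)       ≡⟨ sym (filter-reject Q? ¬q) ⟩
    filter Q? (x ∷ filter P? l)   ≡⟨ cong (filter Q?) (sym (filter-accept P? p)) ⟩
    filter Q? (filter P? (x ∷ l)) ∎
  by-cases (no ¬p) (yes q) = begin
    filter P? (filter Q? (x ∷ l)) ≡⟨ cong (filter P?) (filter-accept Q? q) ⟩
    filter P? (x ∷ filter Q? l)   ≡⟨ filter-reject P? ¬p ⟩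
    filter P? (filter Q? l)       ≡⟨ filter-comm P? Q? l ⟩
    filter Q? (filter P? l)       ≡⟨ cong (filter Q?) (sym (filter-reject P? ¬p)) ⟩
    filter Q? (filter P? (x ∷ l)) ∎
  by-cases (no ¬p) (no ¬q) = begin
    filter P? (filter Q? (x ∷ l)) ≡⟨ cong (filter P?) (filter-reject Q? ¬q) ⟩
    filter P? (filter Q? l)       ≡⟨ filter-comm P? Q? l ⟩
    filter Q? (filter P? l)       ≡⟨ cong (filter Q?) (sym (filter-reject P? ¬p)) ⟩
    filter Q? (filter P? (x ∷ l)) ∎

module Rounds {V : Set} (_≟_ : DecidableEquality V)
              (allV : List V) (allV-unique : Unique allV) (allV-complete : ∀ v → v ∈ allV)
              (Lo Hi : V → ℕ) (N : ℕ) (key : ℕ → V → ℕ) (key<N : ∀ t v → key t v < N) where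
  open Alternation _≟_

  active : ℕ → V → Bool
  active t v = does (Lo v ≤? t) ∧ does (t ≤? Hi v)

  inBucket : ℕ → ℕ → V → Bool
  inBucket t k w = active t w ∧ does (key t w ≟ℕ k)

  bucket : ℕ → ℕ → List V
  bucket t k = filter (λ w → T? (inBucket t k w)) allV

  below : ℕ → ℕ → List V
  below t zero    = []
  below t (suc k) = bucket t k ++ below t k

  round : ℕ → List V
  round t = below t N

  word : ℕ → List V
  word zero    = []
  word (suc t) = word t ++ round t

  active⇒ : ∀ t w → active t w ≡ true → Lo w ≤ t × t ≤ Hi w
  active⇒ t w h with Equivalence.to T-∧ (Equivalence.from T-≡ h)
  ... | h₁ , h₂ = does-true (Lo w ≤? t) (Equivalence.to T-≡ h₁) , does-true (t ≤? Hi w) (Equivalence.to T-≡ h₂)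

  inactive⇒ : ∀ t w → active t w ≡ false → t < Lo w ⊎ Hi w < t
  inactive⇒ t w = by-cases (Lo w ≤? t) (t ≤? Hi w)
    where
    by-cases : (lo : Dec (Lo w ≤ t)) (hi : Dec (t ≤ Hi w)) → does lo ∧ does hi ≡ false → t < Lo w ⊎ Hi w < t
    by-cases (no ¬lo) _        _ = inj₁ (≰⇒> ¬lo)
    by-cases (yes _)  (no ¬hi) _ = inj₂ (≰⇒> ¬hi)

  active-if : ∀ t w → Lo w ≤ t → t ≤ Hi w → active t w ≡ true
  active-if t w h₁ h₂ = cong₂ _∧_ (dec-true (Lo w ≤? t) h₁) (dec-true (t ≤? Hi w) h₂)

  inactive-before : ∀ t w → t < Lo w → active t w ≡ false
  inactive-before t w h = cong (_∧ does (t ≤? Hi w)) (dec-false (Lo w ≤? t) (<⇒≱ h))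

  inactive-after : ∀ t w → Hi w < t → active t w ≡ false
  inactive-after t w h = trans (cong (does (Lo w ≤? t) ∧_) (dec-false (t ≤? Hi w) (<⇒≱ h))) (∧-zeroʳ _)

  ∈-word : ∀ v t T → t < T → active t v ≡ true → v ∈ word T
  ∈-word v t T t<T act = ∈-rounds T t<T (∈-below N (key<N t v)
    (∈-filter⁺ (λ w → T? (inBucket t (key t v) w)) (allV-complete v)
      (Equivalence.from T-≡ (cong₂ _∧_ act (dec-true (key t v ≟ℕ key t v) refl)))))
    where
    ∈-below : ∀ K → key t v < K → v ∈ bucket t (key t v) → v ∈ below t K
    ∈-below (suc K) lt h with m<1+n⇒m<n∨m≡n lt
    ... | inj₂ refl = ∈-++⁺ˡ h
    ... | inj₁ l    = ∈-++⁺ʳ (bucket t K) (∈-below K l h)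
    ∈-rounds : ∀ T → t < T → v ∈ round t → v ∈ word T
    ∈-rounds (suc T) lt h with m<1+n⇒m<n∨m≡n lt
    ... | inj₂ refl = ∈-++⁺ʳ (word t) h
    ... | inj₁ l    = ∈-++⁺ˡ (∈-rounds T l h)

  module Pair (u v : V) (u≢v : u ≢ v) where
    open TwoBuckets using (buckets; buckets≡pair)
    open TwoBuckets u v using (pair)

    Order : Set
    Order = restrict₂ allV u v ≡ u ∷ v ∷ [] ⊎ restrict₂ allV u v ≡ v ∷ u ∷ []

    order : Order
    order = restrict₂-enumeration allV u v allV-unique (allV-complete u) (allV-complete v) u≢v

    firstBy : Order → ℕ → Bool
    firstBy (inj₁ _) t = does (key t v ≤? key t u)
    firstBy (inj₂ _) t = not (does (key t u ≤? key t v))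

    uFirst : ℕ → Bool
    uFirst = firstBy order

    uFirst-if : ∀ t → key t v < key t u → uFirst t ≡ true
    uFirst-if t lt with order
    ... | inj₁ _ = dec-true (key t v ≤? key t u) (<⇒≤ lt)
    ... | inj₂ _ = cong not (dec-false (key t u ≤? key t v) (<⇒≱ lt))

    vFirst-if : ∀ t → key t u < key t v → uFirst t ≡ false
    vFirst-if t lt with order
    ... | inj₁ _ = dec-false (key t v ≤? key t u) (<⇒≱ lt)
    ... | inj₂ _ = cong not (dec-true (key t u ≤? key t v) (<⇒≤ lt))

    shape : ℕ → List V
    shape t = pair (active t u) (active t v) (uFirst t)

    restrict-below : ∀ t a b → restrict₂ allV u v ≡ a ∷ b ∷ [] → ∀ k →
                     restrict₂ (below t k) u v ≡ buckets a b (active t a) (active t b) (key t a) (key t b) k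
    restrict-below t a b e zero = refl
    restrict-below t a b e (suc k) = trans (restrict₂-++ (bucket t k) (below t k) u v)
      (cong₂ _++_ (trans (filter-comm (λ z → (z ≟ u) ⊎-dec (z ≟ v)) (λ w → T? (inBucket t k w)) allV)
                         (trans (cong (filter (λ w → T? (inBucket t k w))) e) (filter-two (inBucket t k) a b)))
                  (restrict-below t a b e k))

    restrict-round : ∀ t → restrict₂ (round t) u v ≡ shape t
    restrict-round t = by-order order
      where
      below-N : ∀ w → active t w ∧ does (key t w <? N) ≡ active t w
      below-N w = trans (cong (active t w ∧_) (dec-true (key t w <? N) (key<N t w))) (∧-identityʳ _)
      by-order : (o : Order) → restrict₂ (round t) u v ≡ pair (active t u) (active t v) (firstBy o t)
      by-order (inj₁ e) = trans (restrict-below t u v e N)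
        (trans (buckets≡pair u v (active t u) (active t v) (key t u) (key t v) N)
               (cong₂ (λ p q → pair p q _) (below-N u) (below-N v)))
      by-order (inj₂ e) = trans (restrict-below t v u e N)
        (trans (buckets≡pair v u (active t v) (active t u) (key t v) (key t u) N)
               (trans (cong₂ (λ p q → TwoBuckets.pair v u p q _) (below-N v) (below-N u))
                      (pair-swap v u (active t v) (active t u) _)))

    pairWord : ℕ → List V
    pairWord zero    = []
    pairWord (suc t) = pairWord t ++ shape t

    restrict-word : ∀ T → restrict₂ (word T) u v ≡ pairWord T
    restrict-word zero    = refl
    restrict-word (suc t) = trans (restrict₂-++ (word t) (round t) u v) (cong₂ _++_ (restrict-word t) (restrict-round t))

    -- the letter last seen before round t, and how long ago it could occur
    LastSeen : ℕ → Maybe V → Set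
    LastSeen t nothing  = ⊤
    LastSeen t (just x) = (x ≡ u × Lo u < t) ⊎ (x ≡ v × suc (Hi u) < t)

    LastSeen-suc : ∀ t m → LastSeen t m → LastSeen (suc t) m
    LastSeen-suc t nothing  _                  = tt
    LastSeen-suc t (just x) (inj₁ (e , h)) = inj₁ (e , m<n⇒m<1+n h)
    LastSeen-suc t (just x) (inj₂ (e , h)) = inj₂ (e , m<n⇒m<1+n h)

    -- If v starts at most one round after u and ends at most one round
    -- after u, and v comes first whenever both are active, then u and v
    -- alternate: each round contributes u, v u, or v, in a valid order.
    module Alternates (lo₁ : Lo u ≤ Lo v) (lo₂ : Lo v ≤ suc (Lo u)) (hi₁ : Hi u ≤ Hi v) (hi₂ : Hi v ≤ suc (Hi u))
                      (vFirst : ∀ t → active t u ≡ true → active t v ≡ true → uFirst t ≡ false) where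

      round-step : ∀ t m → LastSeen t m → NoRepeatAfter m (shape t) × LastSeen (suc t) (lastOf m (shape t))
      round-step t m seen with active t u in au | active t v in av
      ... | true | true rewrite vFirst t au av = continue m seen , inj₁ (refl , s≤s (proj₁ (active⇒ t u au)))
        where
        continue : ∀ m → LastSeen t m → NoRepeatAfter m (v ∷ u ∷ [])
        continue nothing  _                     = ≢-sym u≢v , tt
        continue (just x) (inj₁ (refl , _))     = u≢v , ≢-sym u≢v , tt
        continue (just x) (inj₂ (refl , late)) = ⊥-elim (<⇒≱ late (m≤n⇒m≤1+n (proj₂ (active⇒ t u au))))
      ... | true | false = continue m seen , inj₁ (refl , s≤s (proj₁ (active⇒ t u au)))
        where
        continue : ∀ m → LastSeen t m → NoRepeatAfter m (u ∷ [])
        continue nothing  _ = tt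
        continue (just x) (inj₁ (refl , lt)) with inactive⇒ t v av
        ... | inj₁ early = ⊥-elim (<⇒≱ lt (≤-pred (≤-trans early lo₂)))
        ... | inj₂ late  = ⊥-elim (<⇒≱ late (≤-trans (proj₂ (active⇒ t u au)) hi₁))
        continue (just x) (inj₂ (refl , late)) = ⊥-elim (<⇒≱ late (m≤n⇒m≤1+n (proj₂ (active⇒ t u au))))
      ... | false | true = continue m seen , inj₂ (refl , s≤s u-over)
        where
        u-over : Hi u < t
        u-over with inactive⇒ t u au
        ... | inj₁ early = ⊥-elim (<⇒≱ early (≤-trans lo₁ (proj₁ (active⇒ t v av))))
        ... | inj₂ late  = late
        continue : ∀ m → LastSeen t m → NoRepeatAfter m (v ∷ [])
        continue nothing  _                     = tt
        continue (just x) (inj₁ (refl , _))     = u≢v , tt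
        continue (just x) (inj₂ (refl , late)) = ⊥-elim (<⇒≱ late (≤-trans (proj₂ (active⇒ t v av)) hi₂))
      ... | false | false = Chain-[] {_≢_} m , LastSeen-suc t m seen

      alternates : ∀ T → NoRepeatAfter nothing (pairWord T) × LastSeen T (lastOf nothing (pairWord T))
      alternates zero = tt , tt
      alternates (suc t) with alternates t
      ... | ok , seen with round-step t (lastOf nothing (pairWord t)) seen
      ... | ok' , seen' = Chain-++⁺ nothing (pairWord t) (shape t) ok ok' ,
                          subst (LastSeen (suc t)) (sym (lastOf-++ nothing (pairWord t) (shape t))) seen'

    headOf : List V → Maybe V
    headOf []      = nothing
    headOf (x ∷ _) = just x

    shape-u : ∀ t → active t u ≡ true → active t v ≡ false → shape t ≡ u ∷ []
    shape-u t au av rewrite au | av = refl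

    shape-uv : ∀ t → active t u ≡ true → active t v ≡ true → uFirst t ≡ true → shape t ≡ u ∷ v ∷ []
    shape-uv t au av o rewrite au | av | o = refl

    shape-vu : ∀ t → active t u ≡ true → active t v ≡ true → uFirst t ≡ false → shape t ≡ v ∷ u ∷ []
    shape-vu t au av o rewrite au | av | o = refl

    pairWord-prefix : ∀ t T → t ≤ T → Σ (List V) λ s → pairWord T ≡ pairWord t ++ s
    pairWord-prefix t zero z≤n = [] , refl
    pairWord-prefix t (suc T) le with m≤n⇒m<n∨m≡n le
    ... | inj₂ refl = [] , sym (++-identityʳ _)
    ... | inj₁ lt with pairWord-prefix t T (≤-pred lt)
    ... | s , e = s ++ shape T , trans (cong (_++ shape T) e) (++-assoc (pairWord t) s (shape T))

    repeat-across : ∀ T t x → suc t < T → lastOf nothing (shape t) ≡ just x → headOf (shape (suc t)) ≡ just x →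
                    ¬ NoRepeatAfter nothing (pairWord T)
    repeat-across T t x lt last first ok with pairWord-prefix (suc (suc t)) T lt
    ... | s , e with Chain-++⁻ nothing (pairWord (suc (suc t))) s (subst (NoRepeatAfter nothing) e ok)
    ... | ok₂ , _ with Chain-++⁻ nothing (pairWord t ++ shape t) (shape (suc t)) ok₂
    ... | _ , ok₃ = repeated (shape (suc t)) (subst (λ m → NoRepeatAfter m (shape (suc t))) last-before ok₃) first
      where
      last-before : lastOf nothing (pairWord t ++ shape t) ≡ just x
      last-before = trans (lastOf-++ nothing (pairWord t) (shape t)) (nonempty (shape t) last _)
        where
        nonempty : ∀ l → lastOf nothing l ≡ just x → ∀ p → lastOf p l ≡ just x
        nonempty (y ∷ l) e p = e
      repeated : ∀ l → NoRepeatAfter (just x) l → headOf l ≢ just x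
      repeated (y ∷ l) (ne , _) refl = ne refl

    order-flip : ∀ T t₁ t₂ → t₁ ≤ t₂ → t₂ < T →
                 (∀ t → t₁ ≤ t → t ≤ t₂ → active t u ≡ true × active t v ≡ true) →
                 uFirst t₁ ≢ uFirst t₂ → ¬ NoRepeatAfter nothing (pairWord T)
    order-flip T t₁ zero z≤n lt both ne = ⊥-elim (ne refl)
    order-flip T t₁ (suc t₂) le lt both ne with m≤n⇒m<n∨m≡n le
    ... | inj₂ refl = ⊥-elim (ne refl)
    ... | inj₁ t₁≤t₂ with uFirst t₂ ≟Bool uFirst (suc t₂)
    ... | yes equal = order-flip T t₁ t₂ (≤-pred t₁≤t₂) (<-trans (n<1+n t₂) lt)
                       (λ t a b → both t a (m≤n⇒m≤1+n b)) (λ e → ne (trans e equal))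
    ... | no changes with both t₂ (≤-pred t₁≤t₂) (n≤1+n t₂) | both (suc t₂) le ≤-refl
    ... | au , av | au' , av' with uFirst t₂ in o | uFirst (suc t₂) in o'
    ... | true  | true  = ⊥-elim (changes refl)
    ... | false | false = ⊥-elim (changes refl)
    ... | true  | false = repeat-across T t₂ v lt (cong (lastOf nothing) (shape-uv t₂ au av o))
                            (cong headOf (shape-vu (suc t₂) au' av' o'))
    ... | false | true  = repeat-across T t₂ u lt (cong (lastOf nothing) (shape-vu t₂ au av o))
                            (cong headOf (shape-uv (suc t₂) au' av' o'))

    alone-twice : ∀ T t → suc t < T → active t u ≡ true → active t v ≡ false →
                  active (suc t) u ≡ true → active (suc t) v ≡ false → ¬ NoRepeatAfter nothing (pairWord T)
    alone-twice T t lt au av au' av' =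
      repeat-across T t u lt (cong (lastOf nothing) (shape-u t au av)) (cong headOf (shape-u (suc t) au' av'))

-- Arithmetic of keys 10 · s + 9 · c, where s is a height sum and c a
-- perturbation.
module KeyArithmetic where

  sum-wins : ∀ s s' c c' → suc s ≤ s' → c ≤ suc c' → 10 * s + 9 * c < 10 * s' + 9 * c'
  sum-wins s s' c c' h₁ h₂ = ≤-trans (s≤s (+-monoʳ-≤ (10 * s) (*-monoʳ-≤ 9 h₂)))
    (≤-trans (≤-reflexive (solve 2 (λ s c' → con 1 :+ (con 10 :* s :+ con 9 :* (con 1 :+ c'))
                                          := con 10 :* (con 1 :+ s) :+ con 9 :* c') refl s c'))
             (+-monoˡ-≤ (9 * c') (*-monoʳ-≤ 10 h₁)))

  perturbation-wins : ∀ δ s c c' → δ ≤ 2 → suc δ + c' ≤ c → 10 * (δ + s) + 9 * c' < 10 * s + 9 * c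
  perturbation-wins 0 s c c' _ h = +-monoʳ-< (10 * s) (*-monoʳ-< 9 h)
  perturbation-wins 1 s c c' _ h = ≤-trans (m≤n+m _ 7)
    (≤-trans (≤-reflexive (solve 2 (λ s c' → con 7 :+ (con 1 :+ (con 10 :* (con 1 :+ s) :+ con 9 :* c'))
                                          := con 10 :* s :+ con 9 :* (con 2 :+ c')) refl s c'))
             (+-monoʳ-≤ (10 * s) (*-monoʳ-≤ 9 h)))
  perturbation-wins 2 s c c' _ h = ≤-trans (m≤n+m _ 6)
    (≤-trans (≤-reflexive (solve 2 (λ s c' → con 6 :+ (con 1 :+ (con 10 :* (con 2 :+ s) :+ con 9 :* c'))
                                          := con 10 :* s :+ con 9 :* (con 3 :+ c')) refl s c'))
             (+-monoʳ-≤ (10 * s) (*-monoʳ-≤ 9 h)))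
  perturbation-wins (suc (suc (suc _))) s c c' (s≤s (s≤s ())) h

  ∸-step : ∀ a b c → c ≤ suc b → a ∸ b ≤ suc (a ∸ c)
  ∸-step a b zero _ = ≤-trans (m∸n≤m a b) (n≤1+n a)
  ∸-step zero b (suc c) _ = ≤-trans (≤-reflexive (0∸n≡0 b)) z≤n
  ∸-step (suc a) zero (suc .zero) (s≤s z≤n) = ≤-refl
  ∸-step (suc a) (suc b) (suc c) (s≤s h) = ∸-step a b c h

  ∸-gap : ∀ a i i' k → k + i ≤ i' → i' ≤ a → k + (a ∸ i') ≤ a ∸ i
  ∸-gap a zero i' k h₁ h₂ = ≤-trans (≤-reflexive (+-comm k (a ∸ i')))
    (≤-trans (+-monoʳ-≤ (a ∸ i') (≤-trans (≤-reflexive (sym (+-identityʳ k))) h₁)) (≤-reflexive (m∸n+n≡m h₂)))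
  ∸-gap (suc a) (suc i) (suc i') k h₁ (s≤s h₂) = ∸-gap a i i' k (≤-pred (≤-trans (≤-reflexive (sym (+-suc k i))) h₁)) h₂
  ∸-gap a (suc i) zero k h₁ _ = ⊥-elim (1+n≰0 (≤-trans (m≤n+m (suc i) k) h₁))
    where
    1+n≰0 : ∀ {x} → ¬ suc x ≤ 0
    1+n≰0 ()

-- Vertex (i , j) takes
-- part in rounds P i, …, K + Q j; in every round the participants are
-- listed by decreasing key 10 · (P i + Q j) + 9 · c, where the
-- perturbation c vanishes except in the special rounds M + 2, M + 4,
-- M + 6, M + 8, during which every vertex is active.  Adjacent vertices
-- are oriented by the heights and then alternate; for non-adjacent ones
-- the activity intervals or the perturbations make some letter repeat.
module GridWord {m n : ℕ} (d : Triangulation m n)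
                (even : ∀ a b → 2 + a ≤ m → 2 + b ≤ n → oddDegree (diagAt d) a b ≡ false) where
  open Even d even
  open KeyArithmetic

  Vtx : Set
  Vtx = GridVertex m n

  _≟V_ : DecidableEquality Vtx
  _≟V_ = ≡-dec FinP._≟_ FinP._≟_

  allV : List Vtx
  allV = cartesianProduct (allFin (suc m)) (allFin (suc n))

  row col : Vtx → ℕ
  row v = toℕ (proj₁ v)
  col v = toℕ (proj₂ v)

  row≤ : ∀ v → row v ≤ m
  row≤ v = toℕ≤ (proj₁ v)

  col≤ : ∀ v → col v ≤ n
  col≤ v = toℕ≤ (proj₂ v)

  S : Vtx → ℕ
  S v = P (row v) + Q (col v)

  M K : ℕ
  M = m + m
  K = 9 + M

  P≤M : ∀ v → P (row v) ≤ M
  P≤M v = ≤-trans (R.height-≤ (row v)) (+-monoʳ-≤ m (row≤ v))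

  Q≤2n : ∀ v → Q (col v) ≤ n + n
  Q≤2n v = ≤-trans (C.height-≤ (col v)) (+-monoʳ-≤ n (col≤ v))

  perturbation : ℕ → ℕ → ℕ → ℕ
  perturbation 2 i j = i
  perturbation 4 i j = m ∸ i
  perturbation 6 i j = j
  perturbation 8 i j = n ∸ j
  perturbation _ i j = 0

  perturbation≤ : ∀ r i j → i ≤ m → j ≤ n → perturbation r i j ≤ m + n
  perturbation≤ 0 i j _ _ = z≤n
  perturbation≤ 1 i j _ _ = z≤n
  perturbation≤ 2 i j hi _ = ≤-trans hi (m≤m+n m n)
  perturbation≤ 3 i j _ _ = z≤n
  perturbation≤ 4 i j _ _ = ≤-trans (m∸n≤m m i) (m≤m+n m n)
  perturbation≤ 5 i j _ _ = z≤n
  perturbation≤ 6 i j _ hj = ≤-trans hj (m≤n+m n m)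
  perturbation≤ 7 i j _ _ = z≤n
  perturbation≤ 8 i j _ _ = ≤-trans (m∸n≤m n j) (m≤n+m n m)
  perturbation≤ (suc (suc (suc (suc (suc (suc (suc (suc (suc _))))))))) i j _ _ = z≤n

  keyAt : ℕ → Vtx → ℕ → ℕ
  keyAt r v s = 10 * s + 9 * perturbation r (row v) (col v)

  key : ℕ → Vtx → ℕ
  key t v = keyAt (t ∸ M) v (S v)

  N : ℕ
  N = suc (10 * (M + (n + n)) + 9 * (m + n))

  key<N : ∀ t v → key t v < N
  key<N t v = s≤s (+-mono-≤ (*-monoʳ-≤ 10 (+-mono-≤ (P≤M v) (Q≤2n v)))
                            (*-monoʳ-≤ 9 (perturbation≤ (t ∸ M) (row v) (col v) (row≤ v) (col≤ v))))

  Lo Hi : Vtx → ℕ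
  Lo v = P (row v)
  Hi v = K + Q (col v)

  open Rounds _≟V_ allV (cartesianProduct⁺ (allFin⁺ (suc m)) (allFin⁺ (suc n)))
              (λ v → ∈-cartesianProduct⁺ (∈-allFin (proj₁ v)) (∈-allFin (proj₂ v))) Lo Hi N key key<N public
  open Alternation _≟V_

  -- the number of rounds; kept abstract so that the word is never unfolded
  abstract
    total : ℕ
    total = 2 + K + (n + n)

    total-def : total ≡ 2 + K + (n + n)
    total-def = refl

  W : List Vtx
  W = word total

  perturbation-step : ∀ r {i j i' j'} → Precedes i j i' j' → perturbation r i j ≤ suc (perturbation r i' j')
  perturbation-step 0 pr = z≤n
  perturbation-step 1 pr = z≤n
  perturbation-step 2 pr = Precedes.i≤1+i' pr
  perturbation-step 3 pr = z≤n
  perturbation-step 4 {i} {j} {i'} pr = ∸-step m i i' (Precedes.i'≤1+i pr)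
  perturbation-step 5 pr = z≤n
  perturbation-step 6 pr = Precedes.j≤1+j' pr
  perturbation-step 7 pr = z≤n
  perturbation-step 8 {i} {j} {i'} {j'} pr = ∸-step n j j' (Precedes.j'≤1+j pr)
  perturbation-step (suc (suc (suc (suc (suc (suc (suc (suc (suc _))))))))) pr = z≤n

  -- oriented neighbours alternate: v starts and ends at most one round
  -- after u, and v always has the larger key
  precedes⇒alternating : ∀ u v → u ≢ v → Precedes (row u) (col u) (row v) (col v) → Alternating W u v
  precedes⇒alternating u v u≢v pr = subst (NoRepeatAfter nothing) (sym (restrict-word total)) (proj₁ (alternates total))
    where
    open Pair u v u≢v
    open Precedes pr
    open Alternates P≤P' P'≤1+P (+-monoʳ-≤ K Q≤Q') (≤-trans (+-monoʳ-≤ K Q'≤1+Q) (≤-reflexive (+-suc K (Q (col u)))))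
      (λ t _ _ → vFirst-if t (sum-wins (S u) (S v) _ _ S<S' (perturbation-step (t ∸ M) pr)))

  Separated : Vtx → Vtx → Set
  Separated u v = ¬ Alternating W u v

  separated-sym : ∀ {u v} → Separated v u → Separated u v
  separated-sym {u} {v} h a = h (alternating-sym W v u a)

  separated-if : ∀ u v (u≢v : u ≢ v) → ¬ NoRepeatAfter nothing (Pair.pairWord u v u≢v total) → Separated u v
  separated-if u v u≢v h a = h (subst (NoRepeatAfter nothing) (Pair.restrict-word u v u≢v total) a)

  Lo<K : ∀ w → Lo w < K
  Lo<K w = ≤-trans (s≤s (P≤M w)) (m≤n+m (suc M) 8)

  K≤Hi : ∀ w → K ≤ Hi w
  K≤Hi w = m≤m+n K _

  Hi<total : ∀ w → suc (Hi w) < total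
  Hi<total w = subst (suc (Hi w) <_) (sym total-def) (s≤s (s≤s (+-monoʳ-≤ K (Q≤2n w))))

  special-active : ∀ r w → 1 ≤ r → r ≤ 8 → active (r + M) w ≡ true
  special-active r w h₁ h₂ = active-if (r + M) w (≤-trans (P≤M w) (≤-trans (n≤1+n M) (+-monoˡ-≤ M h₁)))
    (≤-trans (+-monoˡ-≤ M h₂) (≤-trans (n≤1+n (8 + M)) (K≤Hi w)))

  special<total : ∀ r → r ≤ 8 → r + M < total
  special<total r h = subst (r + M <_) (sym total-def)
    (s≤s (≤-trans (+-monoˡ-≤ M h) (≤-trans (n≤1+n (8 + M)) (≤-trans (m≤m+n K (n + n)) (n≤1+n _)))))

  key-special : ∀ r w → key (r + M) w ≡ keyAt r w (S w)
  key-special r w = cong (λ x → keyAt x w (S w)) (m+n∸n≡m r M)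

  special-flip : ∀ u v → u ≢ v → ∀ r₁ r₂ → 1 ≤ r₁ → r₁ ≤ 8 → 1 ≤ r₂ → r₂ ≤ 8 →
                 keyAt r₁ u (S u) < keyAt r₁ v (S v) → keyAt r₂ v (S v) < keyAt r₂ u (S u) → Separated u v
  special-flip u v u≢v r₁ r₂ a₁ b₁ a₂ b₂ k₁ k₂ = separated-if u v u≢v (by-order (≤-total r₁ r₂))
    where
    open Pair u v u≢v
    v-first : uFirst (r₁ + M) ≡ false
    v-first = vFirst-if (r₁ + M) (subst₂ _<_ (sym (key-special r₁ u)) (sym (key-special r₁ v)) k₁)
    u-first : uFirst (r₂ + M) ≡ true
    u-first = uFirst-if (r₂ + M) (subst₂ _<_ (sym (key-special r₂ v)) (sym (key-special r₂ u)) k₂)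
    both : ∀ {r r'} → 1 ≤ r → r' ≤ 8 → ∀ t → r + M ≤ t → t ≤ r' + M → active t u ≡ true × active t v ≡ true
    both a b t h₁ h₂ = active-if t u (≤-trans (P≤M u) (≤-trans (n≤1+n M) (≤-trans (+-monoˡ-≤ M a) h₁)))
                                     (≤-trans h₂ (≤-trans (+-monoˡ-≤ M b) (≤-trans (n≤1+n (8 + M)) (K≤Hi u))))
                     , active-if t v (≤-trans (P≤M v) (≤-trans (n≤1+n M) (≤-trans (+-monoˡ-≤ M a) h₁)))
                                     (≤-trans h₂ (≤-trans (+-monoˡ-≤ M b) (≤-trans (n≤1+n (8 + M)) (K≤Hi v))))
    by-order : r₁ ≤ r₂ ⊎ r₂ ≤ r₁ → ¬ NoRepeatAfter nothing (pairWord total)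
    by-order (inj₁ r₁≤r₂) = order-flip total (r₁ + M) (r₂ + M) (+-monoˡ-≤ M r₁≤r₂) (special<total r₂ b₂) (both a₁ b₂)
                              (λ e → false≢true (trans (sym v-first) (trans e u-first)))
    by-order (inj₂ r₂≤r₁) = order-flip total (r₂ + M) (r₁ + M) (+-monoˡ-≤ M r₂≤r₁) (special<total r₁ b₁) (both a₂ b₁)
                              (λ e → false≢true (trans (sym v-first) (trans (sym e) u-first)))

  record Exceeds (g : ℕ) (u v : Vtx) : Set where
    field
      r     : ℕ
      1≤r   : 1 ≤ r
      r≤8   : r ≤ 8
      ahead : g + perturbation r (row v) (col v) ≤ perturbation r (row u) (col u)

  rows-apart : ∀ g u v → g + row v ≤ row u → Exceeds g u v
  rows-apart g u v h = record { r = 2 ; 1≤r = s≤s z≤n ; r≤8 = s≤s (s≤s z≤n) ; ahead = h }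

  rows-apart′ : ∀ g u v → g + row u ≤ row v → Exceeds g u v
  rows-apart′ g u v h = record { r = 4 ; 1≤r = s≤s z≤n ; r≤8 = s≤s (s≤s (s≤s (s≤s z≤n))) ; ahead = ∸-gap m (row u) (row v) g h (row≤ v) }

  cols-apart : ∀ g u v → g + col v ≤ col u → Exceeds g u v
  cols-apart g u v h = record { r = 6 ; 1≤r = s≤s z≤n ; r≤8 = s≤s (s≤s (s≤s (s≤s (s≤s (s≤s z≤n))))) ; ahead = h }

  cols-apart′ : ∀ g u v → g + col u ≤ col v → Exceeds g u v
  cols-apart′ g u v h = record { r = 8 ; 1≤r = s≤s z≤n ; r≤8 = ≤-refl ; ahead = ∸-gap n (col u) (col v) g h (col≤ v) }

  -- v has the larger height sum, so it comes first in special round 1;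
  -- a large enough perturbation puts u first in another special round
  larger-sum-separated : ∀ u v → u ≢ v → ∀ δ → S v ≡ suc δ + S u → δ ≤ 1 → Exceeds (2 + δ) u v → Separated u v
  larger-sum-separated u v u≢v δ eq δ≤1 ex = special-flip u v u≢v 1 r ≤-refl (s≤s z≤n) 1≤r r≤8
    (+-monoˡ-< 0 (*-monoʳ-< 10 (subst (S u <_) (sym eq) (s≤s (m≤n+m (S u) δ)))))
    (subst (λ s → keyAt r v s < keyAt r u (S u)) (sym eq) (perturbation-wins (suc δ) (S u) _ _ (s≤s δ≤1) ahead))
    where open Exceeds ex

  equal-sum-separated : ∀ u v → u ≢ v → S v ≡ S u → Exceeds 1 v u → Exceeds 1 u v → Separated u v
  equal-sum-separated u v u≢v eq ex₁ ex₂ = special-flip u v u≢v (Exceeds.r ex₁) (Exceeds.r ex₂)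
    (Exceeds.1≤r ex₁) (Exceeds.r≤8 ex₁) (Exceeds.1≤r ex₂) (Exceeds.r≤8 ex₂)
    (subst (λ s → keyAt (Exceeds.r ex₁) u (S u) < keyAt (Exceeds.r ex₁) v s) (sym eq)
           (perturbation-wins 0 (S u) _ _ z≤n (Exceeds.ahead ex₁)))
    (subst (λ s → keyAt (Exceeds.r ex₂) v s < keyAt (Exceeds.r ex₂) u (S u)) (sym eq)
           (perturbation-wins 0 (S u) _ _ z≤n (Exceeds.ahead ex₂)))

  Exceeds-weaken : ∀ {g g' u v} → g' ≤ g → Exceeds g u v → Exceeds g' u v
  Exceeds-weaken g'≤g ex = record { Exceeds ex ; ahead = ≤-trans (+-monoˡ-≤ _ g'≤g) (Exceeds.ahead ex) }
    where open Exceeds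

  rows-gap : ∀ g u v → 1 ≤ g → g + row u ≤ row v ⊎ g + row v ≤ row u → Exceeds g u v × Exceeds 1 v u
  rows-gap g u v 1≤g (inj₁ h) = rows-apart′ g u v h , rows-apart 1 v u (≤-trans (+-monoˡ-≤ _ 1≤g) h)
  rows-gap g u v 1≤g (inj₂ h) = rows-apart g u v h , rows-apart′ 1 v u (≤-trans (+-monoˡ-≤ _ 1≤g) h)

  cols-gap : ∀ g u v → 1 ≤ g → g + col u ≤ col v ⊎ g + col v ≤ col u → Exceeds g u v × Exceeds 1 v u
  cols-gap g u v 1≤g (inj₁ h) = cols-apart′ g u v h , cols-apart 1 v u (≤-trans (+-monoˡ-≤ _ 1≤g) h)
  cols-gap g u v 1≤g (inj₂ h) = cols-apart g u v h , cols-apart′ 1 v u (≤-trans (+-monoˡ-≤ _ 1≤g) h)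

  gap-separated : ∀ u v → u ≢ v → ∀ δ → S v ≡ δ + S u → δ ≤ 2 → Exceeds (suc δ) u v × Exceeds 1 v u → Separated u v
  gap-separated u v u≢v zero    eq _         (ex₁ , ex₂) = equal-sum-separated u v u≢v eq ex₂ ex₁
  gap-separated u v u≢v (suc δ) eq (s≤s δ≤1) (ex₁ , _)   = larger-sum-separated u v u≢v δ eq δ≤1 ex₁

  -- a far step between indices whose heights differ by one is odd, hence at least 3
  far-gap : ∀ x y δ → step x y ≡ far → δ ≤ 1 → (δ ≡ 1 → parity y ≡ not (parity x)) →
            (2 + δ) + x ≤ y ⊎ (2 + δ) + y ≤ x
  far-gap x y zero s _ _ = far⇒apart x y s
  far-gap x y (suc zero) s _ odd with far⇒apart x y s
  ... | inj₁ h with m≤n⇒m<n∨m≡n h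
  ...   | inj₁ l    = inj₁ l
  ...   | inj₂ refl = ⊥-elim (not-fixed (parity x) (trans (sym (not-involutive (parity x))) (odd refl)))
  far-gap x y (suc zero) s _ odd | inj₂ h with m≤n⇒m<n∨m≡n h
  ...   | inj₁ l    = inj₂ l
  ...   | inj₂ refl = ⊥-elim (not-fixed (parity y) (trans (odd refl) (not-involutive (not (parity y)))))
  far-gap x y (suc (suc _)) _ (s≤s ()) _

  -- consecutive heights differ by exactly one, so a weak rise is a rise
  -- and a weak fall is a fall
  no-loop : ∀ {x y δ} → x ≡ δ + y → y ≡ suc x → ⊥
  no-loop {x} {y} {δ} e₁ e₂ = m≢1+n+m x (trans e₁ (trans (cong (δ +_) e₂) (+-suc δ x)))

  row-rises : ∀ i δ → i < m → P (suc i) ≡ δ + P i → rowUp i ≡ true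
  row-rises i δ lt eq with rowMove i lt
  ... | inj₁ (r , _)  = r
  ... | inj₂ (_ , dn) = ⊥-elim (no-loop eq dn)

  row-falls : ∀ i δ → i < m → P i ≡ δ + P (suc i) → rowUp i ≡ false
  row-falls i δ lt eq with rowMove i lt
  ... | inj₁ (_ , up) = ⊥-elim (no-loop eq up)
  ... | inj₂ (r , _)  = r

  col-rises : ∀ j δ → j < n → Q (suc j) ≡ δ + Q j → colUp j ≡ true
  col-rises j δ lt eq with colMove j lt
  ... | inj₁ (c , _)  = c
  ... | inj₂ (_ , dn) = ⊥-elim (no-loop eq dn)

  col-falls : ∀ j δ → j < n → Q j ≡ δ + Q (suc j) → colUp j ≡ false
  col-falls j δ lt eq with colMove j lt
  ... | inj₁ (_ , up) = ⊥-elim (no-loop eq up)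
  ... | inj₂ (c , _)  = c

  -- neighbouring indices with weakly rising heights are adjacent, so a
  -- non-adjacent such pair has equal indices
  close-ordered : ∀ i j i' j' δP δQ → i' ≤ m → j' ≤ n → i ≤ m → j ≤ n →
                  P i' ≡ δP + P i → Q j' ≡ δQ + Q j → adjacentB e (i , j) (i' , j') ≡ false →
                  step i i' ≢ far → step j j' ≢ far → i' ≡ i × j' ≡ j
  close-ordered i j i' j' δP δQ hi' hj' hi hj eP eQ h nfi nfj with step i i' in si | step j j' in sj
  ... | far  | _    = ⊥-elim (nfi refl)
  ... | _    | far  = ⊥-elim (nfj refl)
  ... | same | same = same⇒≡ i i' si , same⇒≡ j j' sj
  ... | fwd  | fwd  rewrite fwd⇒≡ i i' si | fwd⇒≡ j j' sj = ⊥-elim (false≢true (trans (sym h)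
      (trans (diagonal-split i j hi' hj') (cong₂ (λ a b → not (a xor b)) (row-rises i δP hi' eP) (col-rises j δQ hj' eQ)))))
  ... | back | back rewrite back⇒≡ i i' si | back⇒≡ j j' sj = ⊥-elim (false≢true (trans (sym h)
      (trans (diagonal-split i' j' hi hj) (cong₂ (λ a b → not (a xor b)) (row-falls i' δP hi eP) (col-falls j' δQ hj eQ)))))
  ... | fwd  | back rewrite fwd⇒≡ i i' si | back⇒≡ j j' sj = ⊥-elim (false≢true (trans (sym h)
      (cong not (trans (diagonal-split i j' hi' hj) (cong₂ (λ a b → not (a xor b)) (row-rises i δP hi' eP) (col-falls j' δQ hj eQ))))))
  ... | back | fwd  rewrite back⇒≡ i i' si | fwd⇒≡ j j' sj = ⊥-elim (false≢true (trans (sym h)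
      (cong not (trans (diagonal-split i' j hi hj') (cong₂ (λ a b → not (a xor b)) (row-falls i' δP hi eP) (col-rises j δQ hj' eQ))))))

  is-far? : ∀ s → s ≡ far ⊎ s ≢ far
  is-far? far  = inj₁ refl
  is-far? back = inj₂ λ ()
  is-far? same = inj₂ λ ()
  is-far? fwd  = inj₂ λ ()

  S-split : ∀ u v δP δQ → P (row v) ≡ δP + P (row u) → Q (col v) ≡ δQ + Q (col u) → S v ≡ (δP + δQ) + S u
  S-split u v δP δQ eP eQ = trans (cong₂ _+_ eP eQ)
    (solve 4 (λ a b x y → (a :+ x) :+ (b :+ y) := (a :+ b) :+ (x :+ y)) refl δP δQ (P (row u)) (Q (col u)))

  Hi-gap : ∀ u v → 2 + Q (col u) ≤ Q (col v) → 2 + Hi u ≤ Hi v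
  Hi-gap u v g = ≤-trans (≤-reflexive (sym (trans (+-suc K _) (cong suc (+-suc K _))))) (+-monoʳ-≤ K g)

  Hi-suc : ∀ u v → Q (col u) ≡ suc (Q (col v)) → Hi u ≡ suc (Hi v)
  Hi-suc u v e = trans (cong (K +_) e) (+-suc K (Q (col v)))

  nonadjacent-sym : ∀ (u v : Vtx) → adjacentB e (coords u) (coords v) ≡ false → adjacentB e (coords v) (coords u) ≡ false
  nonadjacent-sym u v h = trans (adjacentB-sym e (coords v) (coords u)) h

  ordered-separated : ∀ u v → u ≢ v → ∀ δP δQ → δP ≤ 1 → δQ ≤ 1 →
                      P (row v) ≡ δP + P (row u) → Q (col v) ≡ δQ + Q (col u) →
                      adjacentB e (coords u) (coords v) ≡ false → Separated u v
  ordered-separated u v u≢v δP δQ hP hQ eP eQ h with is-far? (step (row u) (row v)) | is-far? (step (col u) (col v))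
  ... | inj₁ far-rows | _ = gap-separated u v u≢v (δP + δQ) (S-split u v δP δQ eP eQ) (+-mono-≤ hP hQ)
        (map₁ (Exceeds-weaken (s≤s (≤-trans (+-monoʳ-≤ δP hQ) (≤-reflexive (+-comm δP 1)))))
          (rows-gap (2 + δP) u v (s≤s z≤n)
            (far-gap (row u) (row v) δP far-rows hP
              (λ { refl → R.consecutive-heights (row u) (row v) (row≤ u) (row≤ v) eP }))))
  ... | inj₂ _ | inj₁ far-cols = gap-separated u v u≢v (δP + δQ) (S-split u v δP δQ eP eQ) (+-mono-≤ hP hQ)
        (map₁ (Exceeds-weaken (s≤s (+-monoˡ-≤ δQ hP)))
          (cols-gap (2 + δQ) u v (s≤s z≤n)
            (far-gap (col u) (col v) δQ far-cols hQ
              (λ { refl → C.consecutive-heights (col u) (col v) (col≤ u) (col≤ v) eQ }))))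
  ... | inj₂ near-rows | inj₂ near-cols =
    ⊥-elim (u≢v (uncurry (λ ei ej → sym (cong₂ _,_ (FinP.toℕ-injective ei) (FinP.toℕ-injective ej)))
      (close-ordered (row u) (col u) (row v) (col v) δP δQ (row≤ v) (col≤ v) (row≤ u) (col≤ u) eP eQ h near-rows near-cols)))

  -- v starts at least two rounds after u: u is alone in rounds Lo u and Lo u + 1
  late-start-separated : ∀ u v → u ≢ v → 2 + Lo u ≤ Lo v → Separated u v
  late-start-separated u v u≢v h = separated-if u v u≢v
    (alone-twice total (Lo u) (≤-trans (s≤s (s≤s (≤-trans (<⇒≤ (Lo<K u)) (K≤Hi u)))) (Hi<total u))
      (active-if (Lo u) u ≤-refl (≤-trans (<⇒≤ (Lo<K u)) (K≤Hi u))) (inactive-before (Lo u) v (≤-trans (n≤1+n _) h))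
      (active-if (suc (Lo u)) u (n≤1+n _) (≤-trans (Lo<K u) (K≤Hi u))) (inactive-before (suc (Lo u)) v h))
    where open Pair u v u≢v

  -- u ends at least two rounds after v: u is alone in rounds Hi v + 1 and Hi v + 2
  early-end-separated : ∀ u v → u ≢ v → 2 + Hi v ≤ Hi u → Separated u v
  early-end-separated u v u≢v h = separated-if u v u≢v
    (alone-twice total (suc (Hi v)) (≤-trans (s≤s h) (<⇒≤ (Hi<total u)))
      (active-if (suc (Hi v)) u (≤-trans (<⇒≤ (Lo<K u)) (≤-trans (K≤Hi v) (n≤1+n _))) (≤-trans (n≤1+n _) h))
      (inactive-after (suc (Hi v)) v ≤-refl)
      (active-if (2 + Hi v) u (≤-trans (<⇒≤ (Lo<K u)) (≤-trans (K≤Hi v) (≤-trans (n≤1+n _) (n≤1+n _)))) h)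
      (inactive-after (2 + Hi v) v (n≤1+n _)))
    where open Pair u v u≢v

  -- v starts one round after u and ends one round before u; in between,
  -- u must come second at first and first at last, which needs a flip
  nested-separated : ∀ u v → u ≢ v → Lo v ≡ suc (Lo u) → Hi u ≡ suc (Hi v) → Separated u v
  nested-separated u v u≢v lo hi = separated-if u v u≢v (by-cases (true-or-false (uFirst t₀)) (true-or-false (uFirst t₁)))
    where
    open Pair u v u≢v
    t₀ t₁ : ℕ
    t₀ = suc (Lo u)
    t₁ = Hi v
    t₀≤t₁ : t₀ ≤ t₁
    t₀≤t₁ = ≤-trans (Lo<K u) (K≤Hi v)
    t₁<total : suc t₁ < total
    t₁<total = Hi<total v
    both : ∀ t → t₀ ≤ t → t ≤ t₁ → active t u ≡ true × active t v ≡ true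
    both t a b = active-if t u (≤-trans (n≤1+n _) a) (≤-trans b (≤-trans (n≤1+n _) (≤-reflexive (sym hi))))
               , active-if t v (≤-trans (≤-reflexive lo) a) b
    u-alone-before : shape (Lo u) ≡ u ∷ []
    u-alone-before = shape-u (Lo u) (active-if (Lo u) u ≤-refl (≤-trans (<⇒≤ (Lo<K u)) (K≤Hi u)))
                                    (inactive-before (Lo u) v (≤-reflexive (sym lo)))
    u-alone-after : shape (suc t₁) ≡ u ∷ []
    u-alone-after = shape-u (suc t₁) (active-if (suc t₁) u (≤-trans (<⇒≤ (Lo<K u)) (≤-trans (K≤Hi v) (n≤1+n _)))
                                                           (≤-reflexive (sym hi)))
                                     (inactive-after (suc t₁) v ≤-refl)
    by-cases : uFirst t₀ ≡ true ⊎ uFirst t₀ ≡ false → uFirst t₁ ≡ true ⊎ uFirst t₁ ≡ false →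
               ¬ NoRepeatAfter nothing (pairWord total)
    by-cases (inj₁ o₀) _ = repeat-across total (Lo u) u (≤-trans (s≤s t₀≤t₁) (<⇒≤ t₁<total))
      (cong (lastOf nothing) u-alone-before)
      (cong headOf (shape-uv t₀ (proj₁ (both t₀ ≤-refl t₀≤t₁)) (proj₂ (both t₀ ≤-refl t₀≤t₁)) o₀))
    by-cases (inj₂ o₀) (inj₂ o₁) = repeat-across total t₁ u t₁<total
      (cong (lastOf nothing) (shape-vu t₁ (proj₁ (both t₁ t₀≤t₁ ≤-refl)) (proj₂ (both t₁ t₀≤t₁ ≤-refl)) o₁))
      (cong headOf u-alone-after)
    by-cases (inj₂ o₀) (inj₁ o₁) = order-flip total t₀ t₁ t₀≤t₁ (<-trans (n<1+n t₁) t₁<total) both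
      (λ e → false≢true (trans (sym o₀) (trans e o₁)))

  nonadjacent-separated : ∀ u v → u ≢ v → adjacentB e (coords u) (coords v) ≡ false → Separated u v
  nonadjacent-separated u v u≢v h with step (Lo u) (Lo v) in sP | step (Q (col u)) (Q (col v)) in sQ
  ... | far | _ with far⇒apart (Lo u) (Lo v) sP
  ...   | inj₁ g = late-start-separated u v u≢v g
  ...   | inj₂ g = separated-sym (late-start-separated v u (≢-sym u≢v) g)
  nonadjacent-separated u v u≢v h | _ | far with far⇒apart (Q (col u)) (Q (col v)) sQ
  ...   | inj₁ g = separated-sym (early-end-separated v u (≢-sym u≢v) (Hi-gap u v g))
  ...   | inj₂ g = early-end-separated u v u≢v (Hi-gap v u g)
  nonadjacent-separated u v u≢v h | fwd | back =
    nested-separated u v u≢v (fwd⇒≡ _ _ sP) (Hi-suc u v (back⇒≡ _ _ sQ))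
  nonadjacent-separated u v u≢v h | back | fwd =
    separated-sym (nested-separated v u (≢-sym u≢v) (back⇒≡ _ _ sP) (Hi-suc v u (fwd⇒≡ _ _ sQ)))
  nonadjacent-separated u v u≢v h | same | same =
    ordered-separated u v u≢v 0 0 z≤n z≤n (same⇒≡ _ _ sP) (same⇒≡ _ _ sQ) h
  nonadjacent-separated u v u≢v h | fwd | same =
    ordered-separated u v u≢v 1 0 ≤-refl z≤n (fwd⇒≡ _ _ sP) (same⇒≡ _ _ sQ) h
  nonadjacent-separated u v u≢v h | same | fwd =
    ordered-separated u v u≢v 0 1 z≤n ≤-refl (same⇒≡ _ _ sP) (fwd⇒≡ _ _ sQ) h
  nonadjacent-separated u v u≢v h | fwd | fwd =
    ordered-separated u v u≢v 1 1 ≤-refl ≤-refl (fwd⇒≡ _ _ sP) (fwd⇒≡ _ _ sQ) h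
  nonadjacent-separated u v u≢v h | back | same = separated-sym
    (ordered-separated v u (≢-sym u≢v) 1 0 ≤-refl z≤n (back⇒≡ _ _ sP) (sym (same⇒≡ _ _ sQ)) (nonadjacent-sym u v h))
  nonadjacent-separated u v u≢v h | same | back = separated-sym
    (ordered-separated v u (≢-sym u≢v) 0 1 z≤n ≤-refl (sym (same⇒≡ _ _ sP)) (back⇒≡ _ _ sQ) (nonadjacent-sym u v h))
  nonadjacent-separated u v u≢v h | back | back = separated-sym
    (ordered-separated v u (≢-sym u≢v) 1 1 ≤-refl ≤-refl (back⇒≡ _ _ sP) (back⇒≡ _ _ sQ) (nonadjacent-sym u v h))

  representation : WordRepresentable (TriangulatedGrid m n d)
  representation = W , (λ v → ∈-word v (suc M) total (special<total 1 (s≤s z≤n)) (special-active 1 v ≤-refl (s≤s z≤n)))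
                     , λ x y x≢y → mk⇔ (to x y x≢y) (from x y x≢y)
    where
    to : ∀ x y → x ≢ y → Alternate (TriangulatedGrid m n d) W x y → GridEdge m n d x y
    to x y x≢y alt with adjacentB e (coords x) (coords y) in adj
    ... | true  = Equivalence.from (edge⇔adjacent x y) adj
    ... | false = ⊥-elim (nonadjacent-separated x y x≢y adj (Equivalence.to (noRepeatAdj⇔ _) alt))
    from : ∀ x y → x ≢ y → GridEdge m n d x y → Alternate (TriangulatedGrid m n d) W x y
    from x y x≢y E = Equivalence.from (noRepeatAdj⇔ _) (by-orientation (edge⇒oriented x y E))
      where
      by-orientation : Oriented (row x) (col x) (row y) (col y) → Alternating W x y
      by-orientation (inj₁ pr) = precedes⇒alternating x y x≢y pr
      by-orientation (inj₂ pr) = alternating-sym W x y (precedes⇒alternating y x (≢-sym x≢y) pr)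

odd-or-even : ∀ {m n} (d : Triangulation m n) →
              (Σ ℕ λ a → Σ ℕ λ b → 2 + a ≤ m × 2 + b ≤ n × oddDegree (diagAt d) a b ≡ true)
              ⊎ (∀ a b → 2 + a ≤ m → 2 + b ≤ n → oddDegree (diagAt d) a b ≡ false)
odd-or-even {m} {n} d with anyUpTo? (λ a → anyUpTo? (λ b → oddDegree (diagAt d) a b ≟Bool true) (pred n)) (pred m)
... | yes (a , a<m , b , b<n , odd) = inj₁ (a , b , interior a<m , interior b<n , odd)
  where
  interior : ∀ {x k} → x < pred k → 2 + x ≤ k
  interior {k = suc k} lt = s≤s lt
... | no none = inj₂ λ a b 2+a≤m 2+b≤n → ≢true⇒≡false (λ odd → none (a , inside 2+a≤m , b , inside 2+b≤n , odd))
  where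
  inside : ∀ {x k} → 2 + x ≤ k → x < pred k
  inside (s≤s lt) = lt
  ≢true⇒≡false : ∀ {x} → x ≢ true → x ≡ false
  ≢true⇒≡false {false} _ = refl
  ≢true⇒≡false {true}  h = ⊥-elim (h refl)

theorem6 : (m n : ℕ) → 1 ≤ m → 1 ≤ n → (d : Triangulation m n) →
           WordRepresentable (TriangulatedGrid m n d) ⇔ ThreeColorable (TriangulatedGrid m n d)
theorem6 m n _ _ d with odd-or-even d
... | inj₁ (a , b , 2+a≤m , 2+b≤n , odd) =
  let (¬word , ¬colour) = oddVertex-obstruction d a b 2+a≤m 2+b≤n odd
  in mk⇔ (⊥-elim ∘ ¬word) (⊥-elim ∘ ¬colour)
... | inj₂ even = mk⇔ (λ _ → Even.colouring d even) (λ _ → GridWord.representation d even)
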